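{- For every integer $a\ge 5$, Player 1 has a winning strategy in the $(a,5)$-game.
   Context: For positive integers $a,b$, the $(a,b)$-game is the following two-player game. Players 1 and 2 alternate moves, Player 1 moving first. After $n$ moves the game state is a permutation $\pi\in\mathcal{S}_n$ (the first move produces $\pi=1$). A move from $\pi\in\mathcal{S}_n$ consists of choosing any $m\in\{1,\dots,n+1\}$ and replacing $\pi$ by $\pi'=\pi'_1\cdots\pi'_n m\in\mathcal{S}_{n+1}$, where $\pi'_i=\pi_i$ if $\pi_i\le m-1$ and $\pi'_i=\pi_i+1$ if $\pi_i\ge m$. The game ends as soon as the current permutation contains an increasing subsequence of length $a$ or a decreasing subsequence of length $b$; the player who made that move loses (the other player wins). -}

module Defs where

open import Data.Nat using (ℕ; zero; suc; _≤_; _<_; _>_; _≤ᵇ_)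
open import Data.Bool using (if_then_else_)
open import Data.List using (List; []; _∷_; map; _++_; [_]; length)
open import Data.List.Relation.Binary.Sublist.Propositional using (_⊆_)
open import Data.List.Relation.Unary.Linked using (Linked)
open import Data.Product using (Σ; ∃; _×_)
open import Data.Sum using (_⊎_)
open import Relation.Nullary using (¬_)
open import Relation.Binary.PropositionalEquality using (_≡_)

-- A permutation π ∈ S_n is represented by its one-line notation π₁ ⋯ πₙ
-- as a list of natural numbers (values in {1,…,n}).

bump : ℕ → ℕ → ℕ
bump m x = if m ≤ᵇ x then suc x else x

-- The move "choose m ∈ {1,…,n+1}": π ↦ π'₁ ⋯ π'ₙ m.
extend : ℕ → List ℕ → List ℕ
extend m π = map (bump m) π ++ [ m ]

Legal : List ℕ → ℕ → Set
Legal π m = 1 ≤ m × m ≤ suc (length π)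

HasIncreasing : ℕ → List ℕ → Set
HasIncreasing a π = Σ (List ℕ) λ s → s ⊆ π × length s ≡ a × Linked _<_ s

HasDecreasing : ℕ → List ℕ → Set
HasDecreasing b π = Σ (List ℕ) λ s → s ⊆ π × length s ≡ b × Linked _>_ s

Ended : ℕ → ℕ → List ℕ → Set
Ended a b π = HasIncreasing a π ⊎ HasDecreasing b π

-- Win a b π  : the player about to move from (non-terminal) state π has a winning strategy.
-- Lose a b π : every move of the player about to move from π either ends the game
--              (so that player loses) or leads to a position won by the opponent.
mutual
  data Win (a b : ℕ) (π : List ℕ) : Set where
    win : (m : ℕ) → Legal π m → ¬ Ended a b (extend m π) → Lose a b (extend m π) → Win a b π

  data Lose (a b : ℕ) (π : List ℕ) : Set where
    lose : ((m : ℕ) → Legal π m → Ended a b (extend m π) ⊎ Win a b (extend m π)) → Lose a b π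

-- Player 1 has a winning strategy in the (a,b)-game: the initial state is the
-- empty permutation (S_0) and Player 1 moves first.
Player1Wins : ℕ → ℕ → Set
Player1Wins a b = Win a b []

-- Read a permutation π of [n] backwards, as ρ = reverse π, so that a move conses a new entry
-- onto ρ.  For a gap g ≤ n (between the values g and g + 1) let lis g be the longest increasing
-- subsequence of π using values ≤ g and lds g the longest decreasing one using values > g.
-- Playing the value g + 1 creates an increasing subsequence of length lis g + 1 and a
-- decreasing one of length lds g + 1, so in the (a, 5)-game only gaps with lds ≤ 3 are worth
-- playing.  For e ≤ 3 let q_e be the least lis over the gaps with lds ≤ e.  The profile
-- (q₀, q₁, q₂, q₃) determines which pairs (lds, lis) can be played, and playing (e, t) raises
-- it to (q₀ ⊔ (t+1), …, q_{e-1} ⊔ (t+1), t + 1, q_{e+1}, …).  In the coordinates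
-- g₁ = a − 1 − q₀, g₂ = q₀ − q₁, g₃ = q₁ − q₂, g₄ = q₂ − q₃ this is a game on four piles
-- whose P-positions are g₄ = F g₁ g₂ g₃, where F = g₂ once g₂ ≥ 4 and otherwise depends on
-- g₁ and g₃ only through their residues (mod 2 and mod 4) and whether they are 0.  Both
-- defining properties of P-positions (no move joins two of them; every other position has a
-- move into one) thus reduce to finitely many residue classes, which are checked by evaluation.
-- Player 1 opens with 1 and after either answer reaches the profile (2, 2, 0, 0), that is
-- the P-position (a − 3, 0, 2, 0).

module Submission where

open import Defs
open import Data.Bool using (true; false)
open import Data.Fin using (Fin; zero; suc; toℕ; fromℕ<; inject₁)
open import Data.Fin.Properties using (toℕ<n; toℕ-injective; toℕ-inject₁; toℕ-fromℕ<)
open import Data.List using (List; []; _∷_; map; [_]; length; reverse)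
open import Data.List.Base using (reverseAcc)
open import Data.List.Properties using (reverse-++; reverse-map; reverse-involutive; length-reverse; length-map)
open import Data.List.Relation.Binary.Sublist.Propositional using (_⊆_; []; _∷_; _∷ʳ_; minimum)
open import Data.List.Relation.Binary.Sublist.Propositional.Properties using (reverse⁺; All-resp-⊆)
open import Data.List.Relation.Unary.All as All using (All; []; _∷_)
import Data.List.Relation.Unary.All.Properties as AllP
open import Data.List.Relation.Unary.Any using (Any; any?; satisfied)
open import Data.List.Relation.Unary.Linked as Linked using (Linked; []; [-]; _∷_)
open import Data.Nat using (ℕ; zero; suc; _+_; _*_; _≤_; _<_; _≤ᵇ_; _<ᵇ_; z≤n; s≤s; s≤s⁻¹; _⊔_)
open import Data.Nat.Induction using (<-wellFounded)
open import Data.Nat.Properties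
open import Data.Nat.Solver using (module +-*-Solver)
open import Data.Product using (Σ; ∃; _×_; _,_; proj₁; proj₂)
open import Data.Sum using (_⊎_; inj₁; inj₂)
import Data.Sum
open import Data.Unit using (⊤; tt)
open import Data.Vec using (Vec; []; _∷_; lookup; replicate; head)
open import Data.Vec.Properties using (lookup-replicate)
open import Function using (id; _∘_; flip; _⇔_; mk⇔; Equivalence)
open import Induction.WellFounded using (Acc; acc)
open import Relation.Binary using (Decidable; tri<; tri≈; tri>)
open import Relation.Binary.PropositionalEquality using (_≡_; _≢_; refl; sym; trans; cong; cong₂; subst; subst₂; module ≡-Reasoning)
open import Relation.Nullary using (Dec; ¬_; yes; no; ¬?; contradiction)
open import Relation.Nullary.Decidable using (_×-dec_; _→-dec_; from-yes; map′)
open import Relation.Nullary.Reflects using (ofʸ; ofⁿ)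

open Equivalence using (to; from)

Linked-reverse : ∀ {A : Set} {R : A → A → Set} {xs} → Linked R xs → Linked (flip R) (reverse xs)
Linked-reverse []        = []
Linked-reverse [-]       = [-]
Linked-reverse l@(_ ∷ _) = go [-] l
  where
  go : ∀ {A : Set} {R : A → A → Set} {x acc xs} → Linked (flip R) (x ∷ acc) → Linked R (x ∷ xs) →
       Linked (flip R) (reverseAcc (x ∷ acc) xs)
  go la [-]      = la
  go la (r ∷ lx) = go (r ∷ la) lx

-- Longest chains

module _ {A : Set} {R : A → A → Set} (R? : Decidable R) where

  longest : A → List A → ℕ
  longest b []      = 0
  longest b (y ∷ ρ) with R? b y
  ... | yes _ = longest b ρ ⊔ suc (longest y ρ)
  ... | no  _ = longest b ρ

  longest-∷-yes : ∀ {b y} ρ → R b y → longest b (y ∷ ρ) ≡ longest b ρ ⊔ suc (longest y ρ)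
  longest-∷-yes {b} {y} ρ r with R? b y
  ... | yes _ = refl
  ... | no ¬r = contradiction r ¬r

  longest-∷-no : ∀ {b y} ρ → ¬ R b y → longest b (y ∷ ρ) ≡ longest b ρ
  longest-∷-no {b} {y} ρ ¬r with R? b y
  ... | yes r = contradiction r ¬r
  ... | no _  = refl

  longest-∷-≥ : ∀ b y ρ → longest b ρ ≤ longest b (y ∷ ρ)
  longest-∷-≥ b y ρ with R? b y
  ... | yes _ = m≤m⊔n _ _
  ... | no  _ = ≤-refl

  longest-none : ∀ {b ρ} → All (λ y → ¬ R b y) ρ → longest b ρ ≡ 0
  longest-none {ρ = y ∷ ρ} (¬r ∷ none) = trans (longest-∷-no ρ ¬r) (longest-none none)
  longest-none []                      = refl

  longest-≡0 : ∀ {b} ρ → longest b ρ ≡ 0 → All (λ y → ¬ R b y) ρ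
  longest-≡0         []      _  = []
  longest-≡0 {b} (y ∷ ρ) eq with R? b y
  ... | yes _ = contradiction (subst (suc (longest y ρ) ≤_) eq (m≤n⊔m _ _)) λ ()
  ... | no ¬r = ¬r ∷ longest-≡0 ρ eq

  longest-sound : ∀ {b t ρ} → t ⊆ ρ → Linked R (b ∷ t) → length t ≤ longest b ρ
  longest-sound []                    _        = z≤n
  longest-sound {b} (y ∷ʳ t⊆ρ)        l        = ≤-trans (longest-sound t⊆ρ l) (longest-∷-≥ b y _)
  longest-sound {ρ = _ ∷ ρ} (refl ∷ t⊆ρ) (r ∷ l) rewrite longest-∷-yes ρ r =
    ≤-trans (s≤s (longest-sound t⊆ρ l)) (m≤n⊔m _ _)

  longest-complete : ∀ {a} b ρ → a ≤ longest b ρ → ∃ λ t → t ⊆ ρ × length t ≡ a × Linked R (b ∷ t)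
  longest-complete {zero}  b ρ _ = [] , minimum ρ , refl , [-]
  longest-complete {suc a} b (y ∷ ρ) a≤ with R? b y
  ... | no _ = let t , t⊆ρ , len , l = longest-complete b ρ a≤ in t , y ∷ʳ t⊆ρ , len , l
  ... | yes r with ⊔-sel (longest b ρ) (suc (longest y ρ))
  ...   | inj₁ eq = let t , t⊆ρ , len , l = longest-complete b ρ (subst (_ ≤_) eq a≤) in t , y ∷ʳ t⊆ρ , len , l
  ...   | inj₂ eq = let t , t⊆ρ , len , l = longest-complete y ρ (s≤s⁻¹ (subst (_ ≤_) eq a≤)) in
                    y ∷ t , refl ∷ t⊆ρ , cong suc len , r ∷ l

  longest-mono : ∀ {b b′} → (∀ {y} → R b y → R b′ y) → ∀ ρ → longest b ρ ≤ longest b′ ρ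
  longest-mono         R⊆ []      = z≤n
  longest-mono {b} {b′} R⊆ (y ∷ ρ) with R? b y | R? b′ y
  ... | yes _ | yes _ = ⊔-monoˡ-≤ _ (longest-mono R⊆ ρ)
  ... | yes r | no ¬r = contradiction (R⊆ r) ¬r
  ... | no  _ | yes _ = ≤-trans (longest-mono R⊆ ρ) (m≤m⊔n _ _)
  ... | no  _ | no  _ = longest-mono R⊆ ρ

  longest-step : ∀ {b b′} → (∀ {y} → R b′ y → R b y ⊎ y ≡ b) → ∀ ρ →
                 longest b′ ρ ≤ suc (longest b ρ)
  longest-step         R⊆ []      = z≤n
  longest-step {b} {b′} R⊆ (y ∷ ρ) with R? b′ y
  ... | no _ = ≤-trans (longest-step R⊆ ρ) (s≤s (longest-∷-≥ b y ρ))
  ... | yes r′ with R⊆ r′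
  ...   | inj₁ r rewrite longest-∷-yes ρ r =
          ⊔-lub (≤-trans (longest-step R⊆ ρ) (s≤s (m≤m⊔n _ _))) (s≤s (≤-trans (n≤1+n _) (m≤n⊔m _ _)))
  ...   | inj₂ refl = ⊔-lub (≤-trans (longest-step R⊆ ρ) (s≤s (longest-∷-≥ y y ρ)))
                            (s≤s (longest-∷-≥ y y ρ))

  longest-map : ∀ {f : A → A} → (∀ {y z} → R (f y) (f z) ⇔ R y z) →
                ∀ {b b₀} → (∀ {y} → R b (f y) ⇔ R b₀ y) → ∀ ρ → longest b (map f ρ) ≡ longest b₀ ρ
  longest-map f-emb         b~b₀ []      = refl
  longest-map {f} f-emb {b} {b₀} b~b₀ (y ∷ ρ) with R? b (f y) | R? b₀ y
  ... | yes _ | yes _ = cong₂ (λ u v → u ⊔ suc v) (longest-map f-emb b~b₀ ρ) (longest-map f-emb f-emb ρ)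
  ... | yes r | no ¬r = contradiction (to b~b₀ r) ¬r
  ... | no ¬r | yes r = contradiction (from b~b₀ r) ¬r
  ... | no  _ | no  _ = longest-map f-emb b~b₀ ρ

  Linked-∷ : ∀ {b t} → All (R b) t → Linked R t → Linked R (b ∷ t)
  Linked-∷ []      _ = [-]
  Linked-∷ (r ∷ _) l = r ∷ l

  longest-reverse-sound : ∀ {a b π} → All (R b) (reverse π) →
                          Σ (List A) (λ s → s ⊆ π × length s ≡ a × Linked (flip R) s) → a ≤ longest b (reverse π)
  longest-reverse-sound all (s , s⊆π , refl , l) =
    subst (_≤ _) (length-reverse s)
      (longest-sound (reverse⁺ s⊆π) (Linked-∷ (All-resp-⊆ (reverse⁺ s⊆π) all) (Linked-reverse l)))

  longest-reverse-complete : ∀ {a b π} → a ≤ longest b (reverse π) →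
                             Σ (List A) (λ s → s ⊆ π × length s ≡ a × Linked (flip R) s)
  longest-reverse-complete {b = b} {π} a≤ =
    let t , t⊆ρ , len , l = longest-complete b (reverse π) a≤ in
    reverse t , subst (reverse t ⊆_) (reverse-involutive π) (reverse⁺ t⊆ρ) ,
    trans (length-reverse t) len , Linked-reverse (Linked.tail l)

-- Gaps of a permutation

lis : List ℕ → ℕ → ℕ
lis ρ g = longest _>?_ (suc g) ρ

lds : List ℕ → ℕ → ℕ
lds ρ g = longest _<?_ g ρ

push : ℕ → List ℕ → List ℕ
push g ρ = suc g ∷ map (bump (suc g)) ρ

reverse-extend : ∀ g π → reverse (extend (suc g) π) ≡ push g (reverse π)
reverse-extend g π =
  trans (reverse-++ (map (bump (suc g)) π) [ suc g ]) (cong (suc g ∷_) (sym (reverse-map (bump (suc g)) π)))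

bump-below : ∀ {m y} → y < m → bump m y ≡ y
bump-below {m} {y} y<m with m ≤ᵇ y | ≤ᵇ-reflects-≤ m y
... | true  | ofʸ m≤y = contradiction y<m (≤⇒≯ m≤y)
... | false | _       = refl

bump-above : ∀ {m y} → m ≤ y → bump m y ≡ suc y
bump-above {m} {y} m≤y with m ≤ᵇ y | ≤ᵇ-reflects-≤ m y
... | true  | _        = refl
... | false | ofⁿ m≰y = contradiction m≤y m≰y

bump-mono-≤ : ∀ m {y z} → y ≤ z → bump m y ≤ bump m z
bump-mono-≤ m {y} {z} y≤z with m ≤? y | m ≤? z
... | yes m≤y | _       rewrite bump-above m≤y | bump-above (≤-trans m≤y y≤z) = s≤s y≤z
... | no  m≰y | yes m≤z rewrite bump-below (≰⇒> m≰y) | bump-above m≤z = m≤n⇒m≤1+n y≤z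
... | no  m≰y | no  m≰z rewrite bump-below (≰⇒> m≰y) | bump-below (≰⇒> m≰z) = y≤z

bump-mono-< : ∀ m {y z} → y < z → bump m y < bump m z
bump-mono-< m {y} {z} y<z with m ≤? y | m ≤? z
... | yes m≤y | _       rewrite bump-above m≤y | bump-above (≤-trans m≤y (<⇒≤ y<z)) = s≤s y<z
... | no  m≰y | yes m≤z rewrite bump-below (≰⇒> m≰y) | bump-above m≤z = m<n⇒m<1+n y<z
... | no  m≰y | no  m≰z rewrite bump-below (≰⇒> m≰y) | bump-below (≰⇒> m≰z) = y<z

bump-<-⇔ : ∀ m {y z} → bump m y < bump m z ⇔ y < z
bump-<-⇔ m {y} {z} = mk⇔ reflect (bump-mono-< m)
  where
  reflect : bump m y < bump m z → y < z
  reflect p with y <? z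
  ... | yes y<z = y<z
  ... | no  y≮z = contradiction p (≤⇒≯ (bump-mono-≤ m (≮⇒≥ y≮z)))

bump-<-below : ∀ {m h y} → h ≤ m → bump m y < h ⇔ y < h
bump-<-below {m} {h} {y} h≤m with m ≤? y
... | yes m≤y rewrite bump-above m≤y =
  mk⇔ (λ p → contradiction p (≤⇒≯ (≤-trans h≤m (m≤n⇒m≤1+n m≤y))))
      (λ p → contradiction p (≤⇒≯ (≤-trans h≤m m≤y)))
... | no  m≰y rewrite bump-below (≰⇒> m≰y) = mk⇔ id id

bump-<-above : ∀ {m h y} → m ≤ suc h → bump m y < suc (suc h) ⇔ y < suc h
bump-<-above {m} {h} {y} m≤1+h with m ≤? y
... | yes m≤y rewrite bump-above m≤y = mk⇔ s≤s⁻¹ s≤s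
... | no  m≰y rewrite bump-below (≰⇒> m≰y) =
  mk⇔ (λ _ → <-≤-trans (≰⇒> m≰y) m≤1+h) (λ p → m<n⇒m<1+n p)

bump->-below : ∀ {m h y} → h < m → h < bump m y ⇔ h < y
bump->-below {m} {h} {y} h<m with m ≤? y
... | yes m≤y rewrite bump-above m≤y =
  mk⇔ (λ _ → <-≤-trans h<m m≤y) (λ p → m<n⇒m<1+n p)
... | no  m≰y rewrite bump-below (≰⇒> m≰y) = mk⇔ id id

bump->-above : ∀ {m h y} → m ≤ suc h → suc h < bump m y ⇔ h < y
bump->-above {m} {h} {y} m≤1+h with m ≤? y
... | yes m≤y rewrite bump-above m≤y = mk⇔ s≤s⁻¹ s≤s
... | no  m≰y rewrite bump-below (≰⇒> m≰y) =
  mk⇔ (λ p → contradiction (<-≤-trans (≰⇒> m≰y) m≤1+h) (<⇒≯ p))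
      (λ p → contradiction p (≤⇒≯ (s≤s⁻¹ (<-≤-trans (≰⇒> m≰y) m≤1+h))))

lis-push-below : ∀ {g g′} ρ → g′ ≤ g → lis (push g ρ) g′ ≡ lis ρ g′
lis-push-below {g} ρ g′≤g =
  trans (longest-∷-no _>?_ _ (≤⇒≯ (s≤s g′≤g)))
        (longest-map _>?_ (λ {y} {z} → bump-<-⇔ (suc g) {z} {y}) (bump-<-below (s≤s g′≤g)) ρ)

lis-push-above : ∀ {g g′} ρ → g ≤ g′ → lis (push g ρ) (suc g′) ≡ lis ρ g′ ⊔ suc (lis ρ g)
lis-push-above {g} ρ g≤g′ =
  trans (longest-∷-yes _>?_ _ (s≤s (s≤s g≤g′)))
        (cong₂ (λ u v → u ⊔ suc v)
          (longest-map _>?_ (λ {y} {z} → bump-<-⇔ (suc g) {z} {y}) (bump-<-above (s≤s g≤g′)) ρ)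
          (longest-map _>?_ (λ {y} {z} → bump-<-⇔ (suc g) {z} {y}) (bump-<-below ≤-refl) ρ))

lds-push-below : ∀ {g g′} ρ → g′ ≤ g → lds (push g ρ) g′ ≡ lds ρ g′ ⊔ suc (lds ρ g)
lds-push-below {g} ρ g′≤g =
  trans (longest-∷-yes _<?_ _ (s≤s g′≤g))
        (cong₂ (λ u v → u ⊔ suc v)
          (longest-map _<?_ (bump-<-⇔ (suc g)) (bump->-below (s≤s g′≤g)) ρ)
          (longest-map _<?_ (bump-<-⇔ (suc g)) (bump->-above ≤-refl) ρ))

lds-push-above : ∀ {g g′} ρ → g ≤ g′ → lds (push g ρ) (suc g′) ≡ lds ρ g′
lds-push-above {g} ρ g≤g′ =
  trans (longest-∷-no _<?_ _ (≤⇒≯ (s≤s g≤g′)))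
        (longest-map _<?_ (bump-<-⇔ (suc g)) (bump->-above (s≤s g≤g′)) ρ)

lis-mono : ∀ ρ {g g′} → g ≤ g′ → lis ρ g ≤ lis ρ g′
lis-mono ρ g≤g′ = longest-mono _>?_ (λ y<1+g → <-≤-trans y<1+g (s≤s g≤g′)) ρ

lds-anti : ∀ ρ {g g′} → g ≤ g′ → lds ρ g′ ≤ lds ρ g
lds-anti ρ g≤g′ = longest-mono _<?_ (≤-<-trans g≤g′) ρ

lis-step : ∀ ρ g → lis ρ (suc g) ≤ suc (lis ρ g)
lis-step ρ g = longest-step _>?_ m<1+n⇒m<n∨m≡n ρ

lds-step : ∀ ρ g → lds ρ g ≤ suc (lds ρ (suc g))
lds-step ρ g = longest-step _<?_ (λ g<y → Data.Sum.map₂ sym (m≤n⇒m<n∨m≡n g<y)) ρ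

lds-<⇒< : ∀ ρ {g w} → lds ρ w < lds ρ g → g < w
lds-<⇒< ρ {g} {w} lt with g <? w
... | yes g<w = g<w
... | no  g≮w = contradiction (lds-anti ρ (≮⇒≥ g≮w)) (<⇒≱ lt)

data Side (g₀ : ℕ) : ℕ → Set where
  left  : ∀ {g} → g ≤ g₀ → Side g₀ g
  right : ∀ {h} → g₀ ≤ h → Side g₀ (suc h)

side : ∀ g₀ g → Side g₀ g
side g₀ zero    = left z≤n
side g₀ (suc g) with g₀ ≤? g
... | yes g₀≤g = right g₀≤g
... | no  g₀≰g = left (≰⇒> g₀≰g)

-- Profiles

LeastLis : List ℕ → ℕ → ℕ → Set
LeastLis ρ e v = (∃ λ g → lds ρ g ≤ e × lis ρ g ≡ v) × (∀ g → lds ρ g ≤ e → v ≤ lis ρ g)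

⊔-<-cancelʳ : ∀ {x y c} → x ⊔ c < y ⊔ c → x < y × c < y
⊔-<-cancelʳ {x} {y} {c} lt with ≤-total y c
... | inj₁ y≤c = contradiction (≤-trans (≤-reflexive (m≤n⇒m⊔n≡n y≤c)) (m≤n⊔m x c)) (<⇒≱ lt)
... | inj₂ c≤y rewrite m≥n⇒m⊔n≡m c≤y = ≤-<-trans (m≤m⊔n x c) lt , ≤-<-trans (m≤n⊔m x c) lt

⊔-≡-cancelʳ : ∀ {x y c} → c < y → x ⊔ c ≡ y ⊔ c → x ≡ y
⊔-≡-cancelʳ {x} {y} {c} c<y eq rewrite m≥n⇒m⊔n≡m (<⇒≤ c<y) with ≤-total x c
... | inj₁ x≤c = contradiction (trans (sym (m≤n⇒m⊔n≡n x≤c)) eq) (<⇒≢ c<y)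
... | inj₂ c≤x = trans (sym (m≥n⇒m⊔n≡m c≤x)) eq

⊔-≡-cases : ∀ {x y c} → x ⊔ c ≡ y ⊔ c → x ≡ y ⊎ y ≤ c
⊔-≡-cases {y = y} {c} eq with y ≤? c
... | yes y≤c = inj₂ y≤c
... | no  y≰c = inj₁ (⊔-≡-cancelʳ (≰⇒> y≰c) eq)

FlatAtDrops : List ℕ → Set
FlatAtDrops ρ = ∀ {h h′} → h′ ≤ h → lds ρ (suc h) < lds ρ h → lis ρ (suc h) ≡ lis ρ h →
                lds ρ h′ ≡ lds ρ h → lis ρ h′ ≡ lis ρ h

module Push (g₀ : ℕ) (ρ : List ℕ) where

  open ≡-Reasoning

  private
    e i : ℕ
    e = lds ρ g₀
    i = lis ρ g₀

  ρ′ : List ℕ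
  ρ′ = push g₀ ρ

  lds-left-> : ∀ {g} → g ≤ g₀ → e < lds ρ′ g
  lds-left-> g≤g₀ rewrite lds-push-below ρ g≤g₀ = m≤n⊔m _ _

  least-push-< : ∀ {j v} → j < e → LeastLis ρ j v → LeastLis ρ′ j (v ⊔ suc i)
  least-push-< {j} {v} j<e ((w , w-layer , w-lis) , least) = (suc w , lds-w , lis-w) , least′
    where
    g₀≤w : g₀ ≤ w
    g₀≤w = <⇒≤ (lds-<⇒< ρ (≤-<-trans w-layer j<e))
    lds-w : lds ρ′ (suc w) ≤ j
    lds-w rewrite lds-push-above ρ g₀≤w = w-layer
    lis-w : lis ρ′ (suc w) ≡ v ⊔ suc i
    lis-w rewrite lis-push-above ρ g₀≤w | w-lis = refl
    least′ : ∀ g → lds ρ′ g ≤ j → v ⊔ suc i ≤ lis ρ′ g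
    least′ g g-layer with side g₀ g
    ... | left g≤g₀ = contradiction (<-≤-trans (<-trans j<e (lds-left-> g≤g₀)) g-layer) (<-irrefl refl)
    ... | right {h} g₀≤h rewrite lis-push-above ρ g₀≤h | lds-push-above ρ g₀≤h =
      ⊔-monoˡ-≤ (suc i) (least h g-layer)

  least-push-≡ : LeastLis ρ′ e (suc i)
  least-push-≡ = (suc g₀ , lds-g₀ , lis-g₀) , least′
    where
    lds-g₀ : lds ρ′ (suc g₀) ≤ e
    lds-g₀ rewrite lds-push-above ρ (≤-refl {g₀}) = ≤-refl
    lis-g₀ : lis ρ′ (suc g₀) ≡ suc i
    lis-g₀ rewrite lis-push-above ρ (≤-refl {g₀}) = m≤n⇒m⊔n≡n (n≤1+n i)
    least′ : ∀ g → lds ρ′ g ≤ e → suc i ≤ lis ρ′ g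
    least′ g g-layer with side g₀ g
    ... | left g≤g₀ = contradiction (<-≤-trans (lds-left-> g≤g₀) g-layer) (<-irrefl refl)
    ... | right g₀≤h rewrite lis-push-above ρ g₀≤h = m≤n⊔m _ _

  least-push-> : ∀ {j v} → e < j → LeastLis ρ j v → LeastLis ρ′ j v
  least-push-> {j} {v} e<j ((w , w-layer , w-lis) , least) = witness , least′
    where
    v≤i : v ≤ i
    v≤i = least g₀ (<⇒≤ e<j)
    witness : ∃ λ g → lds ρ′ g ≤ j × lis ρ′ g ≡ v
    witness with w ≤? g₀
    ... | yes w≤g₀ = w , subst (_≤ j) (sym (lds-push-below ρ w≤g₀)) (⊔-lub w-layer e<j) ,
                     trans (lis-push-below ρ w≤g₀) w-lis
    ... | no  w≰g₀ = g₀ , subst (_≤ j) (sym (lds-push-below ρ ≤-refl)) (⊔-lub (<⇒≤ e<j) e<j) ,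
                     trans (lis-push-below ρ ≤-refl)
                           (≤-antisym (subst (i ≤_) w-lis (lis-mono ρ (<⇒≤ (≰⇒> w≰g₀)))) v≤i)
    least′ : ∀ g → lds ρ′ g ≤ j → v ≤ lis ρ′ g
    least′ g g-layer with side g₀ g
    ... | left g≤g₀ rewrite lis-push-below ρ g≤g₀ | lds-push-below ρ g≤g₀ = least g (≤-trans (m≤m⊔n _ _) g-layer)
    ... | right g₀≤h rewrite lis-push-above ρ g₀≤h = ≤-trans v≤i (≤-trans (n≤1+n i) (m≤n⊔m _ _))

  flat-push-left : FlatAtDrops ρ → ∀ {h h′} → h ≤ g₀ → h′ ≤ h → lds ρ′ (suc h) < lds ρ′ h →
                   lis ρ′ (suc h) ≡ lis ρ′ h → lds ρ′ h′ ≡ lds ρ′ h → lis ρ′ h′ ≡ lis ρ′ h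
  flat-push-left flat {h} {h′} h≤g₀ h′≤h drop same-lis same-lds with m≤n⇒m<n∨m≡n h≤g₀
  ... | inj₂ refl =
    contradiction (trans (sym (trans (lis-push-above ρ ≤-refl) (m≤n⇒m⊔n≡n (n≤1+n i))))
                         (trans same-lis (lis-push-below ρ ≤-refl)))
                  (1+n≢n {i})
  ... | inj₁ 1+h≤g₀ = begin
    lis ρ′ h′  ≡⟨ lis-push-below ρ (≤-trans h′≤h h≤g₀) ⟩
    lis ρ h′   ≡⟨ flat h′≤h (proj₁ drop₀) same-lis₀ same-lds₀ ⟩
    lis ρ h    ≡⟨ lis-push-below ρ h≤g₀ ⟨
    lis ρ′ h   ∎
    where
    drop₀ : lds ρ (suc h) < lds ρ h × suc e < lds ρ h
    drop₀ = ⊔-<-cancelʳ (subst₂ _<_ (lds-push-below ρ 1+h≤g₀) (lds-push-below ρ h≤g₀) drop)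
    same-lis₀ : lis ρ (suc h) ≡ lis ρ h
    same-lis₀ = subst₂ _≡_ (lis-push-below ρ 1+h≤g₀) (lis-push-below ρ h≤g₀) same-lis
    same-lds₀ : lds ρ h′ ≡ lds ρ h
    same-lds₀ = ⊔-≡-cancelʳ (proj₂ drop₀)
      (subst₂ _≡_ (lds-push-below ρ (≤-trans h′≤h h≤g₀)) (lds-push-below ρ h≤g₀) same-lds)

  flat-push-right : FlatAtDrops ρ → ∀ {h h′} → g₀ ≤ h → h′ ≤ suc h →
                    lds ρ′ (suc (suc h)) < lds ρ′ (suc h) → lis ρ′ (suc (suc h)) ≡ lis ρ′ (suc h) →
                    lds ρ′ h′ ≡ lds ρ′ (suc h) → lis ρ′ h′ ≡ lis ρ′ (suc h)
  flat-push-right flat {h} {h′} g₀≤h h′≤1+h drop same-lis same-lds with side g₀ h′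
  ... | left h′≤g₀ =
    contradiction (≤-trans (≤-reflexive (trans same-lds (lds-push-above ρ g₀≤h))) (lds-anti ρ g₀≤h))
                  (<⇒≱ (lds-left-> h′≤g₀))
  ... | right {h₀} g₀≤h₀ = begin
    lis ρ′ (suc h₀)   ≡⟨ lis-push-above ρ g₀≤h₀ ⟩
    lis ρ h₀ ⊔ suc i  ≡⟨ flat-or-low ⟩
    lis ρ h ⊔ suc i   ≡⟨ lis-push-above ρ g₀≤h ⟨
    lis ρ′ (suc h)    ∎
    where
    h₀≤h : h₀ ≤ h
    h₀≤h = s≤s⁻¹ h′≤1+h
    g₀≤1+h : g₀ ≤ suc h
    g₀≤1+h = ≤-trans g₀≤h (n≤1+n h)
    flat-or-low : lis ρ h₀ ⊔ suc i ≡ lis ρ h ⊔ suc i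
    flat-or-low with ⊔-≡-cases (subst₂ _≡_ (lis-push-above ρ g₀≤h) (lis-push-above ρ g₀≤1+h) (sym same-lis))
    ... | inj₁ same = cong (_⊔ suc i) (flat h₀≤h
      (subst₂ _<_ (lds-push-above ρ g₀≤1+h) (lds-push-above ρ g₀≤h) drop) (sym same)
      (subst₂ _≡_ (lds-push-above ρ g₀≤h₀) (lds-push-above ρ g₀≤h) same-lds))
    ... | inj₂ low = trans (m≤n⇒m⊔n≡n (≤-trans (lis-mono ρ h₀≤h) lis-h≤)) (sym (m≤n⇒m⊔n≡n lis-h≤))
      where
      lis-h≤ : lis ρ h ≤ suc i
      lis-h≤ = ≤-trans (lis-mono ρ (n≤1+n h)) low

  flat-push : FlatAtDrops ρ → FlatAtDrops ρ′
  flat-push flat {h} h′≤h with side g₀ h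
  ... | left  h≤g₀ = flat-push-left flat h≤g₀ h′≤h
  ... | right g₀≤h = flat-push-right flat g₀≤h h′≤h

raise : ∀ {k} → Fin k → ℕ → Vec ℕ k → Vec ℕ k
raise zero    v (_ ∷ q) = v ∷ q
raise (suc e) v (x ∷ q) = x ⊔ v ∷ raise e v q

lookup-raise-< : ∀ {k} {e j : Fin k} v q → toℕ j < toℕ e → lookup (raise e v q) j ≡ lookup q j ⊔ v
lookup-raise-< {e = suc e} {zero}  v (x ∷ q) _       = refl
lookup-raise-< {e = suc e} {suc j} v (x ∷ q) (s≤s p) = lookup-raise-< v q p

lookup-raise-≡ : ∀ {k} (e : Fin k) v q → lookup (raise e v q) e ≡ v
lookup-raise-≡ zero    v (x ∷ q) = refl
lookup-raise-≡ (suc e) v (x ∷ q) = lookup-raise-≡ e v q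

lookup-raise-> : ∀ {k} {e j : Fin k} v q → toℕ e < toℕ j → lookup (raise e v q) j ≡ lookup q j
lookup-raise-> {e = zero}  {suc j} v (x ∷ q) _       = refl
lookup-raise-> {e = suc e} {suc j} v (x ∷ q) (s≤s p) = lookup-raise-> v q p

record Represents (k : ℕ) (ρ : List ℕ) (q : Vec ℕ k) : Set where
  field
    entries : All (λ y → 1 ≤ y × y ≤ length ρ) ρ
    least   : ∀ e → LeastLis ρ (toℕ e) (lookup q e)
    lds-≤   : lds ρ 0 ≤ k
    flat    : FlatAtDrops ρ

represents-[] : ∀ k → Represents k [] (replicate k 0)
represents-[] k = record
  { entries = []
  ; least   = λ e → (0 , z≤n , sym (lookup-replicate e 0)) , λ _ _ → ≤-reflexive (lookup-replicate e 0)
  ; lds-≤   = z≤n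
  ; flat    = λ _ drop → contradiction drop (<-irrefl refl)
  }

bump-range : ∀ m {n y} → 1 ≤ y × y ≤ n → 1 ≤ bump m y × bump m y ≤ suc n
bump-range m {y = y} (1≤y , y≤n) with m ≤? y
... | yes m≤y rewrite bump-above m≤y = m≤n⇒m≤1+n 1≤y , s≤s y≤n
... | no  m≰y rewrite bump-below (≰⇒> m≰y) = 1≤y , m≤n⇒m≤1+n y≤n

represents-push : ∀ {k ρ q g} → Represents k ρ q → g ≤ length ρ → (e : Fin k) → lds ρ g ≡ toℕ e →
                  Represents k (push g ρ) (raise e (suc (lis ρ g)) q)
represents-push {k} {ρ} {q} {g} r g≤n e layer = record
  { entries = (s≤s z≤n , s≤s (subst (g ≤_) (sym (length-map (bump (suc g)) ρ)) g≤n))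
              ∷ subst (λ n → All (λ y → 1 ≤ y × y ≤ suc n) (map (bump (suc g)) ρ))
                      (sym (length-map (bump (suc g)) ρ))
                      (AllP.map⁺ (All.map (bump-range (suc g)) entries))
  ; least   = least′
  ; lds-≤   = subst (_≤ k) (sym (lds-push-below ρ z≤n))
                    (⊔-lub lds-≤ (subst (λ x → suc x ≤ k) (sym layer) (toℕ<n e)))
  ; flat    = flat-push flat
  }
  where
  open Represents r
  open Push g ρ
  least′ : ∀ j → LeastLis (push g ρ) (toℕ j) (lookup (raise e (suc (lis ρ g)) q) j)
  least′ j with <-cmp (toℕ j) (toℕ e)
  ... | tri< j<e _ _ = subst (LeastLis (push g ρ) (toℕ j)) (sym (lookup-raise-< _ q j<e))
                             (least-push-< (subst (toℕ j <_) (sym layer) j<e) (least j))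
  ... | tri≈ _ j≡e _ rewrite toℕ-injective j≡e | lookup-raise-≡ e (suc (lis ρ g)) q =
                             subst (λ x → LeastLis (push g ρ) x (suc (lis ρ g))) layer least-push-≡
  ... | tri> _ _ e<j = subst (LeastLis (push g ρ) (toℕ j)) (sym (lookup-raise-> _ q e<j))
                             (least-push-> (subst (_< toℕ j) (sym layer) e<j) (least j))

lis-beyond : ∀ {g g′} ρ → All (_≤ g) ρ → g ≤ g′ → lis ρ g′ ≡ lis ρ g
lis-beyond []      []           _    = refl
lis-beyond (y ∷ ρ) (y≤g ∷ below) g≤g′
  rewrite longest-∷-yes _>?_ ρ (s≤s y≤g) | longest-∷-yes _>?_ ρ (s≤s (≤-trans y≤g g≤g′))
        | lis-beyond ρ below g≤g′ = refl

lds-zero : ∀ ρ {g} → lds ρ g ≤ 0 → All (_≤ g) ρ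
lds-zero ρ lds≤0 = All.map ≮⇒≥ (longest-≡0 _<?_ ρ (n≤0⇒n≡0 lds≤0))

lds-beyond : ∀ {ρ n g} → All (_≤ n) ρ → n ≤ g → lds ρ g ≡ 0
lds-beyond below n≤g = longest-none _<?_ (All.map (λ y≤n → ≤⇒≯ (≤-trans y≤n n≤g)) below)

lis-zero : ∀ {ρ} → All (1 ≤_) ρ → lis ρ 0 ≡ 0
lis-zero positive = longest-none _>?_ (All.map (λ 1≤y → ≤⇒≯ 1≤y) positive)

threshold-crossing : ∀ (f : ℕ → ℕ) {c s w} → s ≤ w → c ≤ f s → f w < c →
                     ∃ λ h → s ≤ h × h < w × c ≤ f h × f (suc h) < c
threshold-crossing f {c} {s} {zero}  z≤n c≤fs fw<c = contradiction c≤fs (<⇒≱ fw<c)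
threshold-crossing f {c} {s} {suc w} s≤w c≤fs fw<c with m≤n⇒m<n∨m≡n s≤w
... | inj₂ refl = contradiction c≤fs (<⇒≱ fw<c)
... | inj₁ s≤w′ with c ≤? f w
...   | yes c≤fw = w , s≤s⁻¹ s≤w′ , ≤-refl , c≤fw , fw<c
...   | no  c≰fw = let h , s≤h , h<w , c≤fh , fh<c = threshold-crossing f (s≤s⁻¹ s≤w′) c≤fs (≰⇒> c≰fw) in
                   h , s≤h , m<n⇒m<1+n h<w , c≤fh , fh<c

discrete-ivt : ∀ (f : ℕ → ℕ) → (∀ x → f (suc x) ≤ suc (f x)) → ∀ {s w t} → s ≤ w → f s ≤ t → t ≤ f w →
               ∃ λ z → s ≤ z × z ≤ w × f z ≡ t
discrete-ivt f step {s} {w} {t} s≤w fs≤t t≤fw with f w ≟ t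
... | yes fw≡t = w , s≤w , ≤-refl , fw≡t
... | no  fw≢t with w | s≤w | m≤n⇒m<n∨m≡n s≤w
...   | _     | _   | inj₂ refl = contradiction (≤-antisym t≤fw fs≤t) (fw≢t ∘ sym)
...   | suc w | _   | inj₁ s≤w′ =
  let t≤fw′ = s≤s⁻¹ (≤-trans (≤∧≢⇒< t≤fw (fw≢t ∘ sym)) (step w))
      z , s≤z , z≤w , fz≡t = discrete-ivt f step (s≤s⁻¹ s≤w′) fs≤t t≤fw′
  in z , s≤z , m≤n⇒m≤1+n z≤w , fz≡t

lis-in-layer0 : ∀ ρ {v g} → LeastLis ρ 0 v → lds ρ g ≤ 0 → lis ρ g ≡ v
lis-in-layer0 ρ {v} {g} ((w , w-layer , w-lis) , least) g-layer with ≤-total g w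
... | inj₁ g≤w = ≤-antisym (subst (lis ρ g ≤_) w-lis (lis-mono ρ g≤w)) (least g g-layer)
... | inj₂ w≤g = trans (lis-beyond ρ (lds-zero ρ w-layer) w≤g) w-lis

layer-end : ∀ ρ {d g w} → lds ρ g ≡ suc d → lds ρ w ≤ d →
            ∃ λ h → g ≤ h × h < w × lds ρ h ≡ suc d × lds ρ (suc h) ≤ d
layer-end ρ {g = g} {w} g-layer w-layer with threshold-crossing (lds ρ) (<⇒≤ g<w) (≤-reflexive (sym g-layer)) (s≤s w-layer)
  where
  g<w : g < w
  g<w = lds-<⇒< ρ (≤-<-trans w-layer (≤-reflexive (sym g-layer)))
... | h , g≤h , h<w , above , below =
  h , g≤h , h<w , ≤-antisym (subst (lds ρ h ≤_) g-layer (lds-anti ρ g≤h)) above , s≤s⁻¹ below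

lis-at-layer-end : ∀ ρ {d y h} → FlatAtDrops ρ → LeastLis ρ (suc d) y → lds ρ h ≡ suc d → lds ρ (suc h) ≤ d →
                   lis ρ (suc h) ≡ lis ρ h → lis ρ h ≡ y
lis-at-layer-end ρ {d} {h = h} flat ((w , w-layer , w-lis) , least) h-layer h-drop same-lis with w ≤? h
... | yes w≤h = trans (sym (flat w≤h drop same-lis w-same)) w-lis
  where
  drop : lds ρ (suc h) < lds ρ h
  drop = ≤-<-trans h-drop (≤-reflexive (sym h-layer))
  w-same : lds ρ w ≡ lds ρ h
  w-same = ≤-antisym (subst (_ ≤_) (sym h-layer) w-layer) (lds-anti ρ w≤h)
... | no  w≰h = ≤-antisym (subst (lis ρ h ≤_) w-lis (lis-mono ρ (<⇒≤ (≰⇒> w≰h)))) (least h (≤-reflexive h-layer))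

Between : ℕ → ℕ → ℕ → Set
Between x y t = y ≤ t × (t < x ⊎ (t ≡ y × x ≡ y))

lis-in-layer : ∀ ρ {d x y g} → FlatAtDrops ρ → LeastLis ρ d x → LeastLis ρ (suc d) y →
               lds ρ g ≡ suc d → Between x y (lis ρ g)
lis-in-layer ρ {d} {x} {y} {g} flat ((w , w-layer , w-lis) , _) least-y g-layer =
  proj₂ least-y g (≤-reflexive g-layer) , below-or-flat
  where
  g≤w : g ≤ w
  g≤w = <⇒≤ (lds-<⇒< ρ (≤-<-trans w-layer (≤-reflexive (sym g-layer))))
  below-or-flat : lis ρ g < x ⊎ (lis ρ g ≡ y × x ≡ y)
  below-or-flat with lis ρ g <? x
  ... | yes below = inj₁ below
  ... | no  ¬below with layer-end ρ g-layer w-layer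
  ...   | h , g≤h , h<w , h-layer , h-drop = inj₂ (g≡y , trans (sym g≡x) g≡y)
    where
    g≡x : lis ρ g ≡ x
    g≡x = ≤-antisym (subst (lis ρ g ≤_) w-lis (lis-mono ρ g≤w)) (≮⇒≥ ¬below)
    flat-to-w : ∀ {z} → g ≤ z → z ≤ w → lis ρ z ≡ lis ρ g
    flat-to-w g≤z z≤w = ≤-antisym (subst (lis ρ _ ≤_) (trans w-lis (sym g≡x)) (lis-mono ρ z≤w)) (lis-mono ρ g≤z)
    g≡y : lis ρ g ≡ y
    g≡y = trans (sym (flat-to-w g≤h (<⇒≤ h<w)))
                (lis-at-layer-end ρ flat least-y h-layer h-drop
                  (trans (flat-to-w (≤-trans g≤h (n≤1+n h)) h<w) (sym (flat-to-w g≤h (<⇒≤ h<w)))))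

gap-in-layer0 : ∀ {ρ v} → All (_≤ length ρ) ρ → LeastLis ρ 0 v → lds ρ (length ρ) ≡ 0 × lis ρ (length ρ) ≡ v
gap-in-layer0 {ρ} below least = lds-n , lis-in-layer0 ρ least (≤-reflexive lds-n)
  where
  lds-n : lds ρ (length ρ) ≡ 0
  lds-n = lds-beyond below ≤-refl

layer-start : ∀ {ρ d x y} → All (1 ≤_) ρ → LeastLis ρ d x → LeastLis ρ (suc d) y → 1 ≤ x →
              ∃ λ s → lds ρ s ≡ suc d × lis ρ s ≡ y
layer-start {ρ} {d} {x} {y} positive (_ , least) ((w , w-layer , w-lis) , least-y) 1≤x with lds ρ 0 ≤? suc d
... | yes lds0≤ =
  0 , ≤-antisym lds0≤ lds0≥ , trans (lis-zero positive) (sym (n≤0⇒n≡0 (subst (y ≤_) (lis-zero positive) (least-y 0 lds0≤))))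
  where
  lds0≥ : suc d ≤ lds ρ 0
  lds0≥ with suc d ≤? lds ρ 0
  ... | yes p = p
  ... | no  p = contradiction (subst (x ≤_) (lis-zero positive) (least 0 (s≤s⁻¹ (≰⇒> p)))) (<⇒≱ 1≤x)
... | no  lds0≰ with threshold-crossing (lds ρ) z≤n (≰⇒> lds0≰) (s≤s w-layer)
...   | h , _ , h<w , above , below =
  suc h , s-layer , ≤-antisym (subst (lis ρ (suc h) ≤_) w-lis (lis-mono ρ h<w)) (least-y (suc h) (≤-reflexive s-layer))
  where
  s-layer : lds ρ (suc h) ≡ suc d
  s-layer = ≤-antisym (s≤s⁻¹ below) (s≤s⁻¹ (≤-trans above (lds-step ρ h)))

gap-below-top : ∀ {ρ n z} → All (_≤ n) ρ → 0 < lds ρ z → z ≤ n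
gap-below-top {ρ} {n} {z} below positive with z ≤? n
... | yes ok  = ok
... | no  z≰n = contradiction (lds-beyond below (<⇒≤ (≰⇒> z≰n))) (<⇒≢ positive ∘ sym)

gap-in-layer : ∀ {ρ d x y t} → All (λ y → 1 ≤ y × y ≤ length ρ) ρ → LeastLis ρ d x → LeastLis ρ (suc d) y →
               1 ≤ x → y ≤ t → t < x ⊎ t ≡ y → ∃ λ g → g ≤ length ρ × lds ρ g ≡ suc d × lis ρ g ≡ t
gap-in-layer {ρ} {d} {x} {y} {t} entries least-x@((w , w-layer , _) , least) least-y 1≤x y≤t t-range
  with layer-start (All.map proj₁ entries) least-x least-y 1≤x
... | s , s-layer , s-lis with layer-end ρ s-layer w-layer
...   | e , s≤e , _ , e-layer , e-drop with hit t-range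
  where
  hit : t < x ⊎ t ≡ y → ∃ λ z → s ≤ z × z ≤ e × lis ρ z ≡ t
  hit (inj₂ t≡y) = s , ≤-refl , s≤e , trans s-lis (sym t≡y)
  hit (inj₁ t<x) = discrete-ivt (lis ρ) (lis-step ρ) s≤e (subst (_≤ t) (sym s-lis) y≤t)
                     (s≤s⁻¹ (≤-trans t<x (≤-trans (least (suc e) e-drop) (lis-step ρ e))))
...     | z , s≤z , z≤e , z-lis =
  z , gap-below-top (All.map proj₂ entries) (≤-trans (s≤s z≤n) (≤-reflexive (sym z-layer))) , z-layer , z-lis
  where
  z-layer : lds ρ z ≡ suc d
  z-layer = ≤-antisym (subst (lds ρ z ≤_) s-layer (lds-anti ρ s≤z)) (subst (_≤ lds ρ z) e-layer (lds-anti ρ z≤e))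

Admissible : ∀ {k} → Vec ℕ k → Fin k → ℕ → Set
Admissible q zero    t = t ≡ lookup q zero
Admissible q (suc d) t = Between (lookup q (inject₁ d)) (lookup q (suc d)) t

Playable : ∀ {k} → Vec ℕ k → Fin k → ℕ → Set
Playable q zero    t = t ≡ lookup q zero
Playable q (suc d) t = Admissible q (suc d) t × 1 ≤ lookup q (inject₁ d)

module _ {k ρ} {q : Vec ℕ (suc k)} (r : Represents (suc k) ρ q) where

  open Represents r

  private
    least-inject₁ : ∀ (d : Fin k) → LeastLis ρ (toℕ d) (lookup q (inject₁ d))
    least-inject₁ d = subst (λ j → LeastLis ρ j (lookup q (inject₁ d))) (toℕ-inject₁ d) (least (inject₁ d))

  admissible : ∀ {g} (e : Fin (suc k)) → lds ρ g ≡ toℕ e → Admissible q e (lis ρ g)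
  admissible zero    layer = lis-in-layer0 ρ (least zero) (≤-reflexive layer)
  admissible (suc d) layer = lis-in-layer ρ flat (least-inject₁ d) (least (suc d)) layer

  playable-gap : ∀ {t} (e : Fin (suc k)) → Playable q e t → ∃ λ g → g ≤ length ρ × lds ρ g ≡ toℕ e × lis ρ g ≡ t
  playable-gap zero refl = length ρ , ≤-refl , gap-in-layer0 (All.map proj₂ entries) (least zero)
  playable-gap (suc d) ((y≤t , range) , 1≤x) =
    gap-in-layer entries (least-inject₁ d) (least (suc d)) 1≤x y≤t (Data.Sum.map₂ proj₁ range)

ends-by-lds : ∀ {k} a π g → k ≤ lds (reverse π) g → Ended a (suc k) (extend (suc g) π)
ends-by-lds {k} a π g k≤ = inj₂ (longest-reverse-complete _<?_ long)
  where
  long : suc k ≤ lds (reverse (extend (suc g) π)) 0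
  long rewrite reverse-extend g π | lds-push-below (reverse π) (z≤n {g}) = ≤-trans (s≤s k≤) (m≤n⊔m _ _)

ends-by-lis : ∀ {b} a π g → a ≤ suc (lis (reverse π) g) → Ended a b (extend (suc g) π)
ends-by-lis a π g a≤ = inj₁ (longest-reverse-complete _>?_ long)
  where
  long : a ≤ lis (reverse (extend (suc g) π)) (suc g)
  long rewrite reverse-extend g π | lis-push-above (reverse π) (≤-refl {g}) = ≤-trans a≤ (m≤n⊔m _ _)

represents⇒¬ended : ∀ {k a π q} → Represents (suc k) (reverse π) q → lookup q zero < a → ¬ Ended a (suc (suc k)) π
represents⇒¬ended {a = a} r q₀<a (inj₁ inc) with Represents.least r zero
... | (w , w-layer , w-lis) , _ =
  <⇒≱ q₀<a (subst (a ≤_) w-lis (longest-reverse-sound _>?_ (All.map s≤s (lds-zero _ w-layer)) inc))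
represents⇒¬ended r _ (inj₂ dec) =
  <⇒≱ (s≤s (Represents.lds-≤ r)) (longest-reverse-sound _<?_ (All.map proj₁ (Represents.entries r)) dec)

-- The pile game

-- Identifies n with n + 4 from 4 on; F and all moves respect these classes.
rep : ℕ → ℕ
rep (suc (suc (suc (suc (suc (suc (suc (suc n)))))))) = rep (suc (suc (suc (suc n))))
rep n = n

rep-suc : ∀ n → rep (suc n) ≡ rep (suc (rep n))
rep-suc 0 = refl
rep-suc 1 = refl
rep-suc 2 = refl
rep-suc 3 = refl
rep-suc 4 = refl
rep-suc 5 = refl
rep-suc 6 = refl
rep-suc 7 = refl
rep-suc (suc (suc (suc (suc (suc (suc (suc (suc n)))))))) = rep-suc (suc (suc (suc (suc n))))

rep-idem : ∀ n → rep (rep n) ≡ rep n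
rep-idem 0 = refl
rep-idem 1 = refl
rep-idem 2 = refl
rep-idem 3 = refl
rep-idem 4 = refl
rep-idem 5 = refl
rep-idem 6 = refl
rep-idem 7 = refl
rep-idem (suc (suc (suc (suc (suc (suc (suc (suc n)))))))) = rep-idem (suc (suc (suc (suc n))))

rep-+ʳ : ∀ m n → rep (m + n) ≡ rep (m + rep n)
rep-+ʳ zero    n = sym (rep-idem n)
rep-+ʳ (suc m) n = trans (rep-suc (m + n)) (trans (cong (rep ∘ suc) (rep-+ʳ m n)) (sym (rep-suc (m + rep n))))

rep-+ : ∀ m n → rep (m + n) ≡ rep (rep m + rep n)
rep-+ m n = begin
  rep (m + n)          ≡⟨ rep-+ʳ m n ⟩
  rep (m + rep n)      ≡⟨ cong rep (+-comm m (rep n)) ⟩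
  rep (rep n + m)      ≡⟨ rep-+ʳ (rep n) m ⟩
  rep (rep n + rep m)  ≡⟨ cong rep (+-comm (rep n) (rep m)) ⟩
  rep (rep m + rep n)  ∎
  where
  open ≡-Reasoning

rep-<8 : ∀ n → rep n < 8
rep-<8 0 = <ᵇ⇒< 0 8 tt
rep-<8 1 = <ᵇ⇒< 1 8 tt
rep-<8 2 = <ᵇ⇒< 2 8 tt
rep-<8 3 = <ᵇ⇒< 3 8 tt
rep-<8 4 = <ᵇ⇒< 4 8 tt
rep-<8 5 = <ᵇ⇒< 5 8 tt
rep-<8 6 = <ᵇ⇒< 6 8 tt
rep-<8 7 = <ᵇ⇒< 7 8 tt
rep-<8 (suc (suc (suc (suc (suc (suc (suc (suc n)))))))) = rep-<8 (suc (suc (suc (suc n))))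

rep-≤ : ∀ n → rep n ≤ n
rep-≤ 0 = ≤-refl
rep-≤ 1 = ≤-refl
rep-≤ 2 = ≤-refl
rep-≤ 3 = ≤-refl
rep-≤ 4 = ≤-refl
rep-≤ 5 = ≤-refl
rep-≤ 6 = ≤-refl
rep-≤ 7 = ≤-refl
rep-≤ (suc (suc (suc (suc (suc (suc (suc (suc n)))))))) = ≤-trans (rep-≤ (suc (suc (suc (suc n))))) (m≤n+m _ 4)

rep-4+ : ∀ n → 4 ≤ rep (4 + n)
rep-4+ 0 = ≤-refl
rep-4+ 1 = n≤1+n _
rep-4+ 2 = ≤-trans (n≤1+n _) (n≤1+n _)
rep-4+ 3 = ≤-trans (n≤1+n _) (≤-trans (n≤1+n _) (n≤1+n _))
rep-4+ (suc (suc (suc (suc n)))) = rep-4+ n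

rep-small : ∀ {n} → rep n < 4 → rep n ≡ n
rep-small {0} _ = refl
rep-small {1} _ = refl
rep-small {2} _ = refl
rep-small {3} _ = refl
rep-small {suc (suc (suc (suc n)))} r<4 = contradiction (rep-4+ n) (<⇒≱ r<4)

data Kind : Set where
  none odd even : Kind

next : Kind → Kind
next none = odd
next odd  = even
next even = odd

kind : ℕ → Kind
kind zero    = none
kind (suc n) = next (kind n)

kind-rep : ∀ n → kind (rep n) ≡ kind n
kind-rep 0 = refl
kind-rep 1 = refl
kind-rep 2 = refl
kind-rep 3 = refl
kind-rep 4 = refl
kind-rep 5 = refl
kind-rep 6 = refl
kind-rep 7 = refl
kind-rep (suc (suc (suc (suc (suc (suc (suc (suc n)))))))) = trans (kind-rep (suc (suc (suc (suc n))))) (period (kind n))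
  where
  period : ∀ k → next (next (next (next k))) ≡ next (next (next (next (next (next (next (next k)))))))
  period none = refl
  period odd  = refl
  period even = refl

∀ᴷ? : {P : Kind → Set} → (∀ k → Dec (P k)) → Dec (∀ k → P k)
∀ᴷ? {P} P? = map′ every (λ f → f none , f odd , f even) (P? none ×-dec P? odd ×-dec P? even)
  where
  every : P none × P odd × P even → ∀ k → P k
  every (p , _ , _) none = p
  every (_ , p , _) odd  = p
  every (_ , _ , p) even = p

∀<? : ∀ n {P : ℕ → Set} → (∀ m → Dec (P m)) → Dec (∀ {m} → m < n → P m)
∀<? n P? = allUpTo? P? n

cyc : ℕ → ℕ → ℕ → ℕ → ℕ → ℕ
cyc w x y z 0 = w
cyc w x y z 1 = x
cyc w x y z 2 = y
cyc w x y z 3 = z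
cyc w x y z (suc (suc (suc (suc c)))) = cyc w x y z c

table : Kind → ℕ → ℕ → ℕ
table none 0 zero    = 0
table none 0 (suc _) = 1
table none 1 c       = cyc 2 0 2 0 c
table none 2 c       = cyc 2 0 2 0 c
table none 3 _       = 3
table odd  0 c       = cyc 3 3 0 2 c
table odd  1 zero    = 0
table odd  1 (suc _) = 1
table odd  2 c       = cyc 2 0 2 0 c
table odd  3 c       = cyc 3 0 2 3 c
table even 0 zero    = 1
table even 0 (suc c) = cyc 0 2 0 2 (suc c)
table even 1 _       = 1
table even 2 c       = cyc 2 3 3 0 c
table even 3 c       = cyc 0 2 3 3 c
table _    n _       = n

table-big : ∀ k {n} c → 4 ≤ n → table k n c ≡ n
table-big none c (s≤s (s≤s (s≤s (s≤s _)))) = refl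
table-big odd  c (s≤s (s≤s (s≤s (s≤s _)))) = refl
table-big even c (s≤s (s≤s (s≤s (s≤s _)))) = refl

table-small : ∀ k {n} → n < 4 → ∀ {c} → c < 8 → table k n c < 4
table-small = from-yes (∀ᴷ? λ k → ∀<? 4 λ n → ∀<? 8 λ c → table k n c <? 4)

F : ℕ → ℕ → ℕ → ℕ
F g₁ g₂ g₃ = table (kind g₁) g₂ (rep g₃)

record Position : Set where
  constructor ⟪_,_,_,_⟫
  field
    g₁ g₂ g₃ g₄ : ℕ

IsP : Position → Set
IsP ⟪ g₁ , g₂ , g₃ , g₄ ⟫ = g₄ ≡ F g₁ g₂ g₃

-- The moves of the permutation game in pile coordinates (see profile-⟶ and admissible-move).
data _⟶_ : Position → Position → Set where
  move₁₂ : ∀ x g₂ g₃ g₄ → ⟪ suc x , g₂ , g₃ , g₄ ⟫ ⟶ ⟪ x , suc g₂ , g₃ , g₄ ⟫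
  move₂₃ : ∀ g₁ t y g₃ g₄ → ⟪ g₁ , suc t + y , g₃ , g₄ ⟫ ⟶ ⟪ g₁ , y , suc t + g₃ , g₄ ⟫
  move₃₄ : ∀ g₁ g₂ t y g₄ → ⟪ g₁ , g₂ , suc t + y , g₄ ⟫ ⟶ ⟪ g₁ , g₂ , y , suc t + g₄ ⟫
  take₄  : ∀ g₁ g₂ g₃ t y → ⟪ g₁ , g₂ , g₃ , suc t + y ⟫ ⟶ ⟪ g₁ , g₂ , g₃ , y ⟫
  skip₁₃ : ∀ x g₃ g₄ → ⟪ suc x , 0 , g₃ , g₄ ⟫ ⟶ ⟪ x , 0 , suc g₃ , g₄ ⟫
  skip₂₄ : ∀ g₁ y g₄ → ⟪ g₁ , suc y , 0 , g₄ ⟫ ⟶ ⟪ g₁ , y , 0 , suc g₄ ⟫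
  skip₁₄ : ∀ x g₄ → ⟪ suc x , 0 , 0 , g₄ ⟫ ⟶ ⟪ x , 0 , 0 , suc g₄ ⟫
  take₃  : ∀ g₁ g₂ y → ⟪ g₁ , g₂ , suc y , 0 ⟫ ⟶ ⟪ g₁ , g₂ , y , 0 ⟫
  take₂  : ∀ g₁ y → ⟪ g₁ , suc y , 0 , 0 ⟫ ⟶ ⟪ g₁ , y , 0 , 0 ⟫
  take₁  : ∀ x → ⟪ suc x , 0 , 0 , 0 ⟫ ⟶ ⟪ x , 0 , 0 , 0 ⟫

-- Player 1 uses the pile-emptying moves only in these forms, which are playable once q₀ ≥ 2.
Realisable : ∀ {g g′} → g ⟶ g′ → Set
Realisable (skip₂₄ _ y _)  = y ≡ 0
Realisable (take₃ _ g₂ y)  = g₂ ≡ 0 × y ≡ 0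
Realisable (take₂ _ y)     = y ≡ 0
Realisable _               = ⊤

table-move₁₂ : ∀ k {n} → n < 4 → ∀ {c} → c < 8 → table (next k) n c ≢ table k (suc n) c
table-move₁₂ = from-yes (∀ᴷ? λ k → ∀<? 4 λ n → ∀<? 8 λ c → ¬? (table (next k) n c ≟ table k (suc n) c))

table-move₂₃ : ∀ k {t} → t < 4 → ∀ {y} → y < 4 → ∀ {c} → c < 8 →
               suc t + y < 4 → table k (suc t + y) c ≢ table k y (rep (suc t + c))
table-move₂₃ = from-yes (∀ᴷ? λ k → ∀<? 4 λ t → ∀<? 4 λ y → ∀<? 8 λ c →
                          suc t + y <? 4 →-dec ¬? (table k (suc t + y) c ≟ table k y (rep (suc t + c))))

table-move₃₄ : ∀ k {n} → n < 4 → ∀ {t} → t < 4 → ∀ {c} → c < 8 →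
               suc t + table k n (rep (suc t + c)) ≢ table k n c
table-move₃₄ = from-yes (∀ᴷ? λ k → ∀<? 4 λ n → ∀<? 4 λ t → ∀<? 8 λ c →
                          ¬? (suc t + table k n (rep (suc t + c)) ≟ table k n c))

table-skip₁₃ : ∀ k {c} → c < 8 → table (next k) 0 c ≢ table k 0 (rep (suc c))
table-skip₁₃ = from-yes (∀ᴷ? λ k → ∀<? 8 λ c → ¬? (table (next k) 0 c ≟ table k 0 (rep (suc c))))

table-skip₂₄ : ∀ k {y} → y < 4 → suc (table k (suc y) 0) ≢ table k y 0
table-skip₂₄ = from-yes (∀ᴷ? λ k → ∀<? 4 λ y → ¬? (suc (table k (suc y) 0) ≟ table k y 0))

table-skip₁₄ : ∀ k → suc (table (next k) 0 0) ≢ table k 0 0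
table-skip₁₄ = from-yes (∀ᴷ? λ k → ¬? (suc (table (next k) 0 0) ≟ table k 0 0))

table-take₃ : ∀ k {n} → n < 4 → ∀ {c} → c < 8 → 0 ≡ table k n (rep (suc c)) → 0 ≢ table k n c
table-take₃ = from-yes (∀ᴷ? λ k → ∀<? 4 λ n → ∀<? 8 λ c → 0 ≟ table k n (rep (suc c)) →-dec ¬? (0 ≟ table k n c))

table-take₂ : ∀ k {y} → y < 4 → 0 ≡ table k (suc y) 0 → 0 ≢ table k y 0
table-take₂ = from-yes (∀ᴷ? λ k → ∀<? 4 λ y → 0 ≟ table k (suc y) 0 →-dec ¬? (0 ≟ table k y 0))

table-take₁ : ∀ k → 0 ≡ table (next k) 0 0 → 0 ≢ table k 0 0
table-take₁ = from-yes (∀ᴷ? λ k → 0 ≟ table (next k) 0 0 →-dec ¬? (0 ≟ table k 0 0))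

F-big : ∀ g₁ {g₂} g₃ → 4 ≤ g₂ → F g₁ g₂ g₃ ≡ g₂
F-big g₁ g₃ = table-big (kind g₁) (rep g₃)

F-small : ∀ g₁ {g₂} g₃ → g₂ < 4 → F g₁ g₂ g₃ < 4
F-small g₁ g₃ g₂<4 = table-small (kind g₁) g₂<4 (rep-<8 g₃)

suc+≢ : ∀ t y → suc t + y ≢ y
suc+≢ t y eq = <⇒≢ (s≤s (m≤n+m y t)) (sym eq)

F-move₁₂ : ∀ x g₂ g₃ → F (suc x) g₂ g₃ ≢ F x (suc g₂) g₃
F-move₁₂ x g₂ g₃ with g₂ <? 4
... | yes g₂<4 = table-move₁₂ (kind x) g₂<4 (rep-<8 g₃)
... | no  g₂≮4 rewrite F-big (suc x) g₃ (≮⇒≥ g₂≮4) | F-big x g₃ (m≤n⇒m≤1+n (≮⇒≥ g₂≮4)) = 1+n≢n ∘ sym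

F-move₂₃ : ∀ g₁ t y g₃ → F g₁ (suc t + y) g₃ ≢ F g₁ y (suc t + g₃)
F-move₂₃ g₁ t y g₃ with suc t + y <? 4
... | yes small = λ eq → table-move₂₃ (kind g₁) (≤-trans (m≤m+n (suc t) y) (<⇒≤ small)) (≤-<-trans (m≤n+m y (suc t)) small)
                           (rep-<8 g₃) small (trans eq (cong (table (kind g₁) y) (rep-+ʳ (suc t) g₃)))
... | no  big rewrite F-big g₁ g₃ (≮⇒≥ big) with y <? 4
...   | yes y<4 = λ eq → contradiction (subst (4 ≤_) eq (≮⇒≥ big)) (<⇒≱ (F-small g₁ (suc t + g₃) y<4))
...   | no  y≮4 rewrite F-big g₁ (suc t + g₃) (≮⇒≥ y≮4) = suc+≢ t y

F-move₃₄ : ∀ g₁ g₂ t y → suc t + F g₁ g₂ (suc t + y) ≢ F g₁ g₂ y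
F-move₃₄ g₁ g₂ t y with g₂ <? 4
... | no  g₂≮4 rewrite F-big g₁ (suc t + y) (≮⇒≥ g₂≮4) | F-big g₁ y (≮⇒≥ g₂≮4) = suc+≢ t g₂
... | yes g₂<4 with t <? 4
...   | yes t<4 = λ eq → table-move₃₄ (kind g₁) g₂<4 t<4 (rep-<8 y)
                           (trans (cong (λ v → suc t + table (kind g₁) g₂ v) (sym (rep-+ʳ (suc t) y))) eq)
...   | no  t≮4 = λ eq → contradiction (≤-trans (m≤n⇒m≤1+n (≮⇒≥ t≮4)) (≤-trans (m≤m+n (suc t) _) (≤-reflexive eq)))
                                        (<⇒≱ (F-small g₁ y g₂<4))

F-skip₁₃ : ∀ x g₃ → F (suc x) 0 g₃ ≢ F x 0 (suc g₃)
F-skip₁₃ x g₃ eq = table-skip₁₃ (kind x) (rep-<8 g₃) (trans eq (cong (table (kind x) 0) (rep-suc g₃)))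

F-skip₂₄ : ∀ g₁ y → suc (F g₁ (suc y) 0) ≢ F g₁ y 0
F-skip₂₄ g₁ y with y <? 4
... | yes y<4 = table-skip₂₄ (kind g₁) y<4
... | no  y≮4 rewrite F-big g₁ 0 (m≤n⇒m≤1+n (≮⇒≥ y≮4)) | F-big g₁ 0 (≮⇒≥ y≮4) = suc+≢ 1 y

F-take₃ : ∀ g₁ g₂ y → 0 ≡ F g₁ g₂ (suc y) → 0 ≢ F g₁ g₂ y
F-take₃ g₁ g₂ y with g₂ <? 4
... | yes g₂<4 = λ eq → table-take₃ (kind g₁) g₂<4 (rep-<8 y) (trans eq (cong (table (kind g₁) g₂) (rep-suc y)))
... | no  g₂≮4 rewrite F-big g₁ (suc y) (≮⇒≥ g₂≮4) = λ eq → contradiction eq (<⇒≢ (≤-trans (s≤s z≤n) (≮⇒≥ g₂≮4)))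

F-take₂ : ∀ g₁ y → 0 ≡ F g₁ (suc y) 0 → 0 ≢ F g₁ y 0
F-take₂ g₁ y with y <? 4
... | yes y<4 = table-take₂ (kind g₁) y<4
... | no  y≮4 rewrite F-big g₁ 0 (m≤n⇒m≤1+n (≮⇒≥ y≮4)) = λ ()

P⟶¬P : ∀ {g g′} → IsP g → g ⟶ g′ → ¬ IsP g′
P⟶¬P p (move₁₂ x g₂ g₃ _)   p′ = F-move₁₂ x g₂ g₃ (trans (sym p) p′)
P⟶¬P p (move₂₃ g₁ t y g₃ _) p′ = F-move₂₃ g₁ t y g₃ (trans (sym p) p′)
P⟶¬P p (move₃₄ g₁ g₂ t y _) p′ = F-move₃₄ g₁ g₂ t y (trans (cong (suc t +_) (sym p)) p′)
P⟶¬P p (take₄ _ _ _ t y)    p′ = suc+≢ t y (trans p (sym p′))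
P⟶¬P p (skip₁₃ x g₃ _)      p′ = F-skip₁₃ x g₃ (trans (sym p) p′)
P⟶¬P p (skip₂₄ g₁ y _)      p′ = F-skip₂₄ g₁ y (trans (cong suc (sym p)) p′)
P⟶¬P p (skip₁₄ x _)         p′ = table-skip₁₄ (kind x) (trans (cong suc (sym p)) p′)
P⟶¬P p (take₃ g₁ g₂ y)      p′ = F-take₃ g₁ g₂ y p p′
P⟶¬P p (take₂ g₁ y)         p′ = F-take₂ g₁ y p p′
P⟶¬P p (take₁ x)            p′ = table-take₁ (kind x) p p′

<-split : ∀ {y n} → y < n → ∃ λ t → n ≡ suc t + y
<-split {zero}  {suc n} _ = n , sym (+-identityʳ (suc n))
<-split {suc y} {suc n} (s≤s y<n) with <-split y<n
... | t , refl = t , sym (+-suc (suc t) y)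

rep-+ˡ : ∀ m n → rep (m + n) ≡ rep (rep m + n)
rep-+ˡ m n = trans (cong rep (+-comm m n)) (trans (rep-+ʳ n m) (cong rep (+-comm n (rep m))))

rep-≡ : ∀ n {v} → v < 4 → rep n ≡ v → n ≡ v
rep-≡ n v<4 eq = trans (sym (rep-small (subst (_< 4) (sym eq) v<4))) eq

data Candidate : Set where
  move₁₂ skip₁₃ skip₂₄ skip₁₄ take₃ take₂ take₁ : Candidate
  move₂₃ move₃₄ : ℕ → Candidate

-- The candidate wins at every position with classes (rep g₁ , rep g₂ , rep g₃ , g₄) = (a , b , c , d);
-- the quantified classes cover the unknown predecessor of g₁ and the unknown amount moved.
Wins : Candidate → ℕ → ℕ → ℕ → ℕ → Set
Wins move₁₂     a b c d = a ≢ 0 × b < 4 × (∀ {x} → x < 8 → rep (suc x) ≡ a → d ≡ table (kind x) (suc b) c)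
Wins (move₂₃ y) a b c d = y < b × (∀ {s} → s < 8 → s ≢ 0 → rep (s + y) ≡ b → d ≡ table (kind a) y (rep (s + c)))
Wins (move₃₄ t) a b c d = suc t ≤ c × b < 4 × (∀ {y} → y < 8 → rep (suc t + y) ≡ c → suc t + d ≡ table (kind a) b y)
Wins skip₁₃     a b c d = b ≡ 0 × a ≢ 0 × (∀ {x} → x < 8 → rep (suc x) ≡ a → d ≡ table (kind x) 0 (rep (suc c)))
Wins skip₂₄     a b c d = b ≡ 1 × c ≡ 0 × suc d ≡ table (kind a) 0 0
Wins skip₁₄     a b c d = b ≡ 0 × c ≡ 0 × a ≢ 0 × (∀ {x} → x < 8 → rep (suc x) ≡ a → suc d ≡ table (kind x) 0 0)
Wins take₃      a b c d = b ≡ 0 × c ≡ 1 × d ≡ 0 × 0 ≡ table (kind a) 0 0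
Wins take₂      a b c d = b ≡ 1 × c ≡ 0 × d ≡ 0 × 0 ≡ table (kind a) 0 0
Wins take₁      a b c d = b ≡ 0 × c ≡ 0 × d ≡ 0 × a ≢ 0 × (∀ {x} → x < 8 → rep (suc x) ≡ a → 0 ≡ table (kind x) 0 0)

wins? : ∀ cand a b c d → Dec (Wins cand a b c d)
wins? move₁₂     a b c d = ¬? (a ≟ 0) ×-dec b <? 4 ×-dec ∀<? 8 λ x → rep (suc x) ≟ a →-dec d ≟ table (kind x) (suc b) c
wins? (move₂₃ y) a b c d = y <? b ×-dec ∀<? 8 λ s → ¬? (s ≟ 0) →-dec rep (s + y) ≟ b →-dec d ≟ table (kind a) y (rep (s + c))
wins? (move₃₄ t) a b c d = suc t ≤? c ×-dec b <? 4 ×-dec ∀<? 8 λ y → rep (suc t + y) ≟ c →-dec suc t + d ≟ table (kind a) b y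
wins? skip₁₃     a b c d = b ≟ 0 ×-dec ¬? (a ≟ 0) ×-dec ∀<? 8 λ x → rep (suc x) ≟ a →-dec d ≟ table (kind x) 0 (rep (suc c))
wins? skip₂₄     a b c d = b ≟ 1 ×-dec c ≟ 0 ×-dec suc d ≟ table (kind a) 0 0
wins? skip₁₄     a b c d = b ≟ 0 ×-dec c ≟ 0 ×-dec ¬? (a ≟ 0) ×-dec ∀<? 8 λ x → rep (suc x) ≟ a →-dec suc d ≟ table (kind x) 0 0
wins? take₃      a b c d = b ≟ 0 ×-dec c ≟ 1 ×-dec d ≟ 0 ×-dec 0 ≟ table (kind a) 0 0
wins? take₂      a b c d = b ≟ 1 ×-dec c ≟ 0 ×-dec d ≟ 0 ×-dec 0 ≟ table (kind a) 0 0
wins? take₁      a b c d = b ≟ 0 ×-dec c ≟ 0 ×-dec d ≟ 0 ×-dec ¬? (a ≟ 0) ×-dec ∀<? 8 λ x → rep (suc x) ≟ a →-dec 0 ≟ table (kind x) 0 0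

candidates : List Candidate
candidates = move₁₂ ∷ move₂₃ 0 ∷ move₂₃ 1 ∷ move₂₃ 2 ∷ move₂₃ 3 ∷ move₃₄ 0 ∷ move₃₄ 1 ∷ move₃₄ 2 ∷ move₃₄ 3 ∷
             skip₁₃ ∷ skip₂₄ ∷ skip₁₄ ∷ take₃ ∷ take₂ ∷ take₁ ∷ []

table-reply : ∀ {a} → a < 8 → ∀ {b} → b < 8 → ∀ {c} → c < 8 → ∀ {d} → d < 4 → d < table (kind a) b c →
              Any (λ cand → Wins cand a b c d) candidates
table-reply = from-yes (∀<? 8 λ a → ∀<? 8 λ b → ∀<? 8 λ c → ∀<? 4 λ d →
                         d <? table (kind a) b c →-dec any? (λ cand → wins? cand a b c d) candidates)

Reply : Position → Set
Reply g = ∃ λ g′ → Σ (g ⟶ g′) Realisable × IsP g′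

wins-sound : ∀ cand {g₁ g₂ g₃ g₄} → Wins cand (rep g₁) (rep g₂) (rep g₃) g₄ → Reply ⟪ g₁ , g₂ , g₃ , g₄ ⟫
wins-sound move₁₂ {zero} (a≢0 , _) = contradiction refl a≢0
wins-sound move₁₂ {suc x} {g₂} {g₃} {g₄} (_ , b<4 , valid) =
  _ , (move₁₂ x g₂ g₃ g₄ , tt) ,
  subst₂ (λ κ n → g₄ ≡ table κ (suc n) (rep g₃)) (kind-rep x) (rep-small b<4) (valid (rep-<8 x) (sym (rep-suc x)))
wins-sound (move₂₃ y) {g₁} {g₂} {g₃} {g₄} (y<b , valid) with <-split (<-≤-trans y<b (rep-≤ g₂))
... | t , refl = _ , (move₂₃ g₁ t y g₃ g₄ , tt) ,
  subst₂ (λ κ v → g₄ ≡ table κ y v) (kind-rep g₁) (sym (rep-+ (suc t) g₃))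
    (valid (rep-<8 (suc t)) (λ eq → 1+n≢0 (rep-≡ (suc t) (s≤s z≤n) eq)) (sym (rep-+ˡ (suc t) y)))
wins-sound (move₃₄ t) {g₁} {g₂} {g₃} {g₄} (t<c , b<4 , valid) with m≤n⇒∃[o]m+o≡n (≤-trans t<c (rep-≤ g₃))
... | y , refl = _ , (move₃₄ g₁ g₂ t y g₄ , tt) ,
  subst₂ (λ κ n → suc t + g₄ ≡ table κ n (rep y)) (kind-rep g₁) (rep-small b<4) (valid (rep-<8 y) (sym (rep-+ʳ (suc t) y)))
wins-sound skip₁₃ {zero} (_ , a≢0 , _) = contradiction refl a≢0
wins-sound skip₁₃ {suc x} {g₂} {g₃} {g₄} (b≡0 , _ , valid) with rep-≡ g₂ (s≤s z≤n) b≡0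
... | refl = _ , (skip₁₃ x g₃ g₄ , tt) ,
  subst₂ (λ κ v → g₄ ≡ table κ 0 v) (kind-rep x) (sym (rep-suc g₃)) (valid (rep-<8 x) (sym (rep-suc x)))
wins-sound skip₂₄ {g₁} {g₂} {g₃} {g₄} (b≡1 , c≡0 , valid) with rep-≡ g₂ (s≤s (s≤s z≤n)) b≡1 | rep-≡ g₃ (s≤s z≤n) c≡0
... | refl | refl = _ , (skip₂₄ g₁ 0 g₄ , refl) , subst (λ κ → suc g₄ ≡ table κ 0 0) (kind-rep g₁) valid
wins-sound skip₁₄ {zero} (_ , _ , a≢0 , _) = contradiction refl a≢0
wins-sound skip₁₄ {suc x} {g₂} {g₃} {g₄} (b≡0 , c≡0 , _ , valid) with rep-≡ g₂ (s≤s z≤n) b≡0 | rep-≡ g₃ (s≤s z≤n) c≡0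
... | refl | refl = _ , (skip₁₄ x g₄ , tt) , subst (λ κ → suc g₄ ≡ table κ 0 0) (kind-rep x) (valid (rep-<8 x) (sym (rep-suc x)))
wins-sound take₃ {g₁} {g₂} {g₃} (b≡0 , c≡1 , refl , valid) with rep-≡ g₂ (s≤s z≤n) b≡0 | rep-≡ g₃ (s≤s (s≤s z≤n)) c≡1
... | refl | refl = _ , (take₃ g₁ 0 0 , refl , refl) , subst (λ κ → 0 ≡ table κ 0 0) (kind-rep g₁) valid
wins-sound take₂ {g₁} {g₂} {g₃} (b≡1 , c≡0 , refl , valid) with rep-≡ g₂ (s≤s (s≤s z≤n)) b≡1 | rep-≡ g₃ (s≤s z≤n) c≡0
... | refl | refl = _ , (take₂ g₁ 0 , refl) , subst (λ κ → 0 ≡ table κ 0 0) (kind-rep g₁) valid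
wins-sound take₁ {zero} (_ , _ , _ , a≢0 , _) = contradiction refl a≢0
wins-sound take₁ {suc x} {g₂} {g₃} (b≡0 , c≡0 , refl , _ , valid) with rep-≡ g₂ (s≤s z≤n) b≡0 | rep-≡ g₃ (s≤s z≤n) c≡0
... | refl | refl = _ , (take₁ x , tt) , subst (λ κ → 0 ≡ table κ 0 0) (kind-rep x) (valid (rep-<8 x) (sym (rep-suc x)))

rep-≥4 : ∀ {n} → 4 ≤ n → 4 ≤ rep n
rep-≥4 4≤n with m≤n⇒∃[o]m+o≡n 4≤n
... | o , refl = rep-4+ o

in-table-region : ∀ g₁ g₂ g₃ {d} → d < 4 → d < F g₁ g₂ g₃ → d < table (kind (rep g₁)) (rep g₂) (rep g₃)
in-table-region g₁ g₂ g₃ d<4 d<F with g₂ <? 4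
... | yes g₂<4 rewrite kind-rep g₁ | rep-small {g₂} (≤-<-trans (rep-≤ g₂) g₂<4) = d<F
... | no  g₂≮4 rewrite table-big (kind (rep g₁)) (rep g₃) (rep-≥4 (≮⇒≥ g₂≮4)) = <-≤-trans d<4 (rep-≥4 (≮⇒≥ g₂≮4))

¬P⟶P : ∀ g → ¬ IsP g → Reply g
¬P⟶P ⟪ g₁ , g₂ , g₃ , g₄ ⟫ ¬p with <-cmp g₄ (F g₁ g₂ g₃)
... | tri≈ _ p _ = contradiction p ¬p
... | tri> _ _ F<g₄ with <-split F<g₄
...   | t , refl = _ , (take₄ g₁ g₂ g₃ t (F g₁ g₂ g₃) , tt) , refl
¬P⟶P ⟪ g₁ , g₂ , g₃ , g₄ ⟫ ¬p | tri< g₄<F _ _ with g₄ <? 4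
... | yes g₄<4 =
  let cand , valid = satisfied (table-reply (rep-<8 g₁) (rep-<8 g₂) (rep-<8 g₃) g₄<4 (in-table-region g₁ g₂ g₃ g₄<4 g₄<F))
  in wins-sound cand valid
... | no  g₄≮4 with 4 ≤? g₂
...   | no  g₂≱4 = contradiction (≤-trans (≮⇒≥ g₄≮4) (<⇒≤ g₄<F)) (<⇒≱ (F-small g₁ g₃ (≰⇒> g₂≱4)))
...   | yes 4≤g₂ with <-split (subst (g₄ <_) (F-big g₁ g₃ 4≤g₂) g₄<F)
...     | t , refl = _ , (move₂₃ g₁ t g₄ g₃ g₄ , tt) , sym (F-big g₁ (suc t + g₃) (≮⇒≥ g₄≮4))

-- Profiles in pile coordinates

open +-*-Solver using (solve; _:=_; con; _:+_; _:*_)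

-- B is q₃, and Budget fixes g₁ = a − 1 − q₀.
profile : ℕ → Position → Vec ℕ 4
profile B ⟪ g₁ , g₂ , g₃ , g₄ ⟫ = B + g₄ + g₃ + g₂ ∷ B + g₄ + g₃ ∷ B + g₄ ∷ B ∷ []

Budget : ℕ → ℕ → Position → Set
Budget a B g = suc (Position.g₁ g + head (profile B g)) ≡ a

layer : ∀ {g g′} → g ⟶ g′ → Fin 4
layer (move₁₂ _ _ _ _)   = zero
layer (move₂₃ _ _ _ _ _) = suc zero
layer (skip₁₃ _ _ _)     = suc zero
layer (move₃₄ _ _ _ _ _) = suc (suc zero)
layer (skip₂₄ _ _ _)     = suc (suc zero)
layer (skip₁₄ _ _)       = suc (suc zero)
layer (take₄ _ _ _ _ _)  = suc (suc (suc zero))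
layer (take₃ _ _ _)      = suc (suc (suc zero))
layer (take₂ _ _)        = suc (suc (suc zero))
layer (take₁ _)          = suc (suc (suc zero))

value : ∀ {g g′} → ℕ → g ⟶ g′ → ℕ
value B (move₁₂ _ g₂ g₃ g₄)  = B + g₄ + g₃ + g₂
value B (move₂₃ _ t _ g₃ g₄) = B + g₄ + g₃ + t
value B (skip₁₃ _ g₃ g₄)     = B + g₄ + g₃
value B (move₃₄ _ _ t _ g₄)  = B + g₄ + t
value B (skip₂₄ _ _ g₄)      = B + g₄
value B (skip₁₄ _ g₄)        = B + g₄
value B (take₄ _ _ _ t _)    = B + t
value B (take₃ _ _ _)        = B
value B (take₂ _ _)          = B
value B (take₁ _)            = B

base : ∀ {g g′} → ℕ → g ⟶ g′ → ℕ
base B (take₄ _ _ _ t _) = suc (B + t)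
base B (take₃ _ _ _)     = suc B
base B (take₂ _ _)       = suc B
base B (take₁ _)         = suc B
base B _                 = B

vec₄-≡ : ∀ {a b c d a′ b′ c′ d′ : ℕ} → a ≡ a′ → b ≡ b′ → c ≡ c′ → d ≡ d′ →
         _≡_ {A = Vec ℕ 4} (a ∷ b ∷ c ∷ d ∷ []) (a′ ∷ b′ ∷ c′ ∷ d′ ∷ [])
vec₄-≡ refl refl refl refl = refl

entry-kept : ∀ {new old v} k → new ≡ v + k → old ≡ v + k → new ≡ old ⊔ v
entry-kept k new≡ old≡ = trans new≡ (sym (trans (cong (_⊔ _) old≡) (m≥n⇒m⊔n≡m (m≤m+n _ k))))

entry-raised : ∀ {new old v} k → new ≡ v → old + k ≡ v → new ≡ old ⊔ v
entry-raised k new≡ old+k≡ = trans new≡ (sym (m≤n⇒m⊔n≡n (≤-trans (m≤m+n _ k) (≤-reflexive old+k≡))))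

profile-⟶ : ∀ {g g′} B (mv : g ⟶ g′) → profile (base B mv) g′ ≡ raise (layer mv) (suc (value B mv)) (profile B g)
profile-⟶ B (move₁₂ x g₂ g₃ g₄) = vec₄-≡ (+-suc (B + g₄ + g₃) g₂) refl refl refl
profile-⟶ B (move₂₃ g₁ t y g₃ g₄) = vec₄-≡
  (entry-kept y (solve 5 (λ B g₄ g₃ t y → B :+ g₄ :+ (con 1 :+ t :+ g₃) :+ y := con 1 :+ (B :+ g₄ :+ g₃ :+ t) :+ y) refl B g₄ g₃ t y)
          (solve 5 (λ B g₄ g₃ t y → B :+ g₄ :+ g₃ :+ (con 1 :+ t :+ y) := con 1 :+ (B :+ g₄ :+ g₃ :+ t) :+ y) refl B g₄ g₃ t y))
  (solve 4 (λ B g₄ g₃ t → B :+ g₄ :+ (con 1 :+ t :+ g₃) := con 1 :+ (B :+ g₄ :+ g₃ :+ t)) refl B g₄ g₃ t)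
  refl refl
profile-⟶ B (skip₁₃ x g₃ g₄) = vec₄-≡
  (entry-raised 1 (solve 3 (λ B g₄ g₃ → B :+ g₄ :+ (con 1 :+ g₃) :+ con 0 := con 1 :+ (B :+ g₄ :+ g₃)) refl B g₄ g₃)
          (solve 3 (λ B g₄ g₃ → B :+ g₄ :+ g₃ :+ con 0 :+ con 1 := con 1 :+ (B :+ g₄ :+ g₃)) refl B g₄ g₃))
  (+-suc (B + g₄) g₃) refl refl
profile-⟶ B (move₃₄ g₁ g₂ t y g₄) = vec₄-≡
  (entry-kept (y + g₂) (solve 5 (λ B g₄ t y g₂ → B :+ (con 1 :+ t :+ g₄) :+ y :+ g₂ := con 1 :+ (B :+ g₄ :+ t) :+ (y :+ g₂)) refl B g₄ t y g₂)
                 (solve 5 (λ B g₄ t y g₂ → B :+ g₄ :+ (con 1 :+ t :+ y) :+ g₂ := con 1 :+ (B :+ g₄ :+ t) :+ (y :+ g₂)) refl B g₄ t y g₂))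
  (entry-kept y (solve 4 (λ B g₄ t y → B :+ (con 1 :+ t :+ g₄) :+ y := con 1 :+ (B :+ g₄ :+ t) :+ y) refl B g₄ t y)
          (solve 4 (λ B g₄ t y → B :+ g₄ :+ (con 1 :+ t :+ y) := con 1 :+ (B :+ g₄ :+ t) :+ y) refl B g₄ t y))
  (solve 3 (λ B g₄ t → B :+ (con 1 :+ t :+ g₄) := con 1 :+ (B :+ g₄ :+ t)) refl B g₄ t)
  refl
profile-⟶ B (skip₂₄ g₁ y g₄) = vec₄-≡
  (entry-kept y (solve 3 (λ B g₄ y → B :+ (con 1 :+ g₄) :+ con 0 :+ y := con 1 :+ (B :+ g₄) :+ y) refl B g₄ y)
          (solve 3 (λ B g₄ y → B :+ g₄ :+ con 0 :+ (con 1 :+ y) := con 1 :+ (B :+ g₄) :+ y) refl B g₄ y))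
  (entry-raised 1 (solve 2 (λ B g₄ → B :+ (con 1 :+ g₄) :+ con 0 := con 1 :+ (B :+ g₄)) refl B g₄)
          (solve 2 (λ B g₄ → B :+ g₄ :+ con 0 :+ con 1 := con 1 :+ (B :+ g₄)) refl B g₄))
  (+-suc B g₄) refl
profile-⟶ B (skip₁₄ x g₄) = vec₄-≡
  (entry-raised 1 (solve 2 (λ B g₄ → B :+ (con 1 :+ g₄) :+ con 0 :+ con 0 := con 1 :+ (B :+ g₄)) refl B g₄)
          (solve 2 (λ B g₄ → B :+ g₄ :+ con 0 :+ con 0 :+ con 1 := con 1 :+ (B :+ g₄)) refl B g₄))
  (entry-raised 1 (solve 2 (λ B g₄ → B :+ (con 1 :+ g₄) :+ con 0 := con 1 :+ (B :+ g₄)) refl B g₄)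
          (solve 2 (λ B g₄ → B :+ g₄ :+ con 0 :+ con 1 := con 1 :+ (B :+ g₄)) refl B g₄))
  (+-suc B g₄) refl
profile-⟶ B (take₄ g₁ g₂ g₃ t y) = vec₄-≡
  (entry-kept (y + g₃ + g₂) (solve 5 (λ B t y g₃ g₂ → con 1 :+ (B :+ t) :+ y :+ g₃ :+ g₂ := con 1 :+ (B :+ t) :+ (y :+ g₃ :+ g₂)) refl B t y g₃ g₂)
                      (solve 5 (λ B t y g₃ g₂ → B :+ (con 1 :+ t :+ y) :+ g₃ :+ g₂ := con 1 :+ (B :+ t) :+ (y :+ g₃ :+ g₂)) refl B t y g₃ g₂))
  (entry-kept (y + g₃) (solve 4 (λ B t y g₃ → con 1 :+ (B :+ t) :+ y :+ g₃ := con 1 :+ (B :+ t) :+ (y :+ g₃)) refl B t y g₃)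
                 (solve 4 (λ B t y g₃ → B :+ (con 1 :+ t :+ y) :+ g₃ := con 1 :+ (B :+ t) :+ (y :+ g₃)) refl B t y g₃))
  (entry-kept y refl (solve 3 (λ B t y → B :+ (con 1 :+ t :+ y) := con 1 :+ (B :+ t) :+ y) refl B t y))
  refl
profile-⟶ B (take₃ g₁ g₂ y) = vec₄-≡
  (entry-kept (y + g₂) (solve 3 (λ B y g₂ → con 1 :+ B :+ con 0 :+ y :+ g₂ := con 1 :+ B :+ (y :+ g₂)) refl B y g₂)
                 (solve 3 (λ B y g₂ → B :+ con 0 :+ (con 1 :+ y) :+ g₂ := con 1 :+ B :+ (y :+ g₂)) refl B y g₂))
  (entry-kept y (solve 2 (λ B y → con 1 :+ B :+ con 0 :+ y := con 1 :+ B :+ y) refl B y)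
          (solve 2 (λ B y → B :+ con 0 :+ (con 1 :+ y) := con 1 :+ B :+ y) refl B y))
  (entry-raised 1 (+-identityʳ (suc B)) (solve 1 (λ B → B :+ con 0 :+ con 1 := con 1 :+ B) refl B))
  refl
profile-⟶ B (take₂ g₁ y) = vec₄-≡
  (entry-kept y (solve 2 (λ B y → con 1 :+ B :+ con 0 :+ con 0 :+ y := con 1 :+ B :+ y) refl B y)
          (solve 2 (λ B y → B :+ con 0 :+ con 0 :+ (con 1 :+ y) := con 1 :+ B :+ y) refl B y))
  (entry-raised 1 (solve 1 (λ B → con 1 :+ B :+ con 0 :+ con 0 := con 1 :+ B) refl B) (solve 1 (λ B → B :+ con 0 :+ con 0 :+ con 1 := con 1 :+ B) refl B))
  (entry-raised 1 (+-identityʳ (suc B)) (solve 1 (λ B → B :+ con 0 :+ con 1 := con 1 :+ B) refl B))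
  refl
profile-⟶ B (take₁ x) = vec₄-≡
  (entry-raised 1 (solve 1 (λ B → con 1 :+ B :+ con 0 :+ con 0 :+ con 0 := con 1 :+ B) refl B) (solve 1 (λ B → B :+ con 0 :+ con 0 :+ con 0 :+ con 1 := con 1 :+ B) refl B))
  (entry-raised 1 (solve 1 (λ B → con 1 :+ B :+ con 0 :+ con 0 := con 1 :+ B) refl B) (solve 1 (λ B → B :+ con 0 :+ con 0 :+ con 1 := con 1 :+ B) refl B))
  (entry-raised 1 (+-identityʳ (suc B)) (solve 1 (λ B → B :+ con 0 :+ con 1 := con 1 :+ B) refl B))
  refl

budget-⟶ : ∀ {a g g′} B (mv : g ⟶ g′) → Budget a B g → Budget a (base B mv) g′
budget-⟶ B (move₁₂ x g₂ g₃ g₄) refl =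
  cong suc (solve 5 (λ x B g₄ g₃ g₂ → x :+ (B :+ g₄ :+ g₃ :+ (con 1 :+ g₂)) := con 1 :+ x :+ (B :+ g₄ :+ g₃ :+ g₂)) refl x B g₄ g₃ g₂)
budget-⟶ B (move₂₃ g₁ t y g₃ g₄) refl =
  cong (λ n → suc (g₁ + n)) (solve 5 (λ B g₄ g₃ t y → B :+ g₄ :+ (con 1 :+ t :+ g₃) :+ y := B :+ g₄ :+ g₃ :+ (con 1 :+ t :+ y)) refl B g₄ g₃ t y)
budget-⟶ B (skip₁₃ x g₃ g₄) refl =
  cong suc (solve 4 (λ x B g₄ g₃ → x :+ (B :+ g₄ :+ (con 1 :+ g₃) :+ con 0) := con 1 :+ x :+ (B :+ g₄ :+ g₃ :+ con 0)) refl x B g₄ g₃)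
budget-⟶ B (move₃₄ g₁ g₂ t y g₄) refl =
  cong (λ n → suc (g₁ + n)) (solve 5 (λ B g₄ t y g₂ → B :+ (con 1 :+ t :+ g₄) :+ y :+ g₂ := B :+ g₄ :+ (con 1 :+ t :+ y) :+ g₂) refl B g₄ t y g₂)
budget-⟶ B (skip₂₄ g₁ y g₄) refl =
  cong (λ n → suc (g₁ + n)) (solve 3 (λ B g₄ y → B :+ (con 1 :+ g₄) :+ con 0 :+ y := B :+ g₄ :+ con 0 :+ (con 1 :+ y)) refl B g₄ y)
budget-⟶ B (skip₁₄ x g₄) refl =
  cong suc (solve 3 (λ x B g₄ → x :+ (B :+ (con 1 :+ g₄) :+ con 0 :+ con 0) := con 1 :+ x :+ (B :+ g₄ :+ con 0 :+ con 0)) refl x B g₄)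
budget-⟶ B (take₄ g₁ g₂ g₃ t y) refl =
  cong (λ n → suc (g₁ + n)) (solve 5 (λ B t y g₃ g₂ → con 1 :+ (B :+ t) :+ y :+ g₃ :+ g₂ := B :+ (con 1 :+ t :+ y) :+ g₃ :+ g₂) refl B t y g₃ g₂)
budget-⟶ B (take₃ g₁ g₂ y) refl =
  cong (λ n → suc (g₁ + n)) (solve 3 (λ B y g₂ → con 1 :+ B :+ con 0 :+ y :+ g₂ := B :+ con 0 :+ (con 1 :+ y) :+ g₂) refl B y g₂)
budget-⟶ B (take₂ g₁ y) refl =
  cong (λ n → suc (g₁ + n)) (solve 2 (λ B y → con 1 :+ B :+ con 0 :+ con 0 :+ y := B :+ con 0 :+ con 0 :+ (con 1 :+ y)) refl B y)
budget-⟶ B (take₁ x) refl =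
  cong suc (solve 2 (λ x B → x :+ (con 1 :+ B :+ con 0 :+ con 0 :+ con 0) := con 1 :+ x :+ (B :+ con 0 :+ con 0 :+ con 0)) refl x B)

top-⟶ : ∀ {g g′} B (mv : g ⟶ g′) → head (profile B g) ≤ head (profile (base B mv) g′)
top-⟶ {g} B mv = subst (head (profile B g) ≤_) (sym (cong head (profile-⟶ B mv))) (raised mv)
  where
  raised : ∀ {g′} (mv : g ⟶ g′) → head (profile B g) ≤ head (raise (layer mv) (suc (value B mv)) (profile B g))
  raised (move₁₂ _ _ _ _)   = n≤1+n _
  raised (move₂₃ _ _ _ _ _) = m≤m⊔n _ _
  raised (skip₁₃ _ _ _)     = m≤m⊔n _ _
  raised (move₃₄ _ _ _ _ _) = m≤m⊔n _ _
  raised (skip₂₄ _ _ _)     = m≤m⊔n _ _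
  raised (skip₁₄ _ _)       = m≤m⊔n _ _
  raised (take₄ _ _ _ _ _)  = m≤m⊔n _ _
  raised (take₃ _ _ _)      = m≤m⊔n _ _
  raised (take₂ _ _)        = m≤m⊔n _ _
  raised (take₁ _)          = m≤m⊔n _ _

μ : Position → ℕ
μ ⟪ g₁ , g₂ , g₃ , g₄ ⟫ = 4 * g₁ + 3 * g₂ + 2 * g₃ + g₄

<-by : ∀ {m n} k → n ≡ m + suc k → m < n
<-by {m} k refl = ≤-trans (s≤s (m≤m+n m k)) (≤-reflexive (sym (+-suc m k)))

μ-⟶ : ∀ {g g′} → g ⟶ g′ → μ g′ < μ g
μ-⟶ (move₁₂ x g₂ g₃ g₄) = <-by 0 (solve 4 (λ x g₂ g₃ g₄ →
  con 4 :* (con 1 :+ x) :+ con 3 :* g₂ :+ con 2 :* g₃ :+ g₄ := con 4 :* x :+ con 3 :* (con 1 :+ g₂) :+ con 2 :* g₃ :+ g₄ :+ con 1) refl x g₂ g₃ g₄)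
μ-⟶ (move₂₃ g₁ t y g₃ g₄) = <-by t (solve 5 (λ g₁ t y g₃ g₄ →
  con 4 :* g₁ :+ con 3 :* (con 1 :+ t :+ y) :+ con 2 :* g₃ :+ g₄ := con 4 :* g₁ :+ con 3 :* y :+ con 2 :* (con 1 :+ t :+ g₃) :+ g₄ :+ (con 1 :+ t)) refl g₁ t y g₃ g₄)
μ-⟶ (skip₁₃ x g₃ g₄) = <-by 1 (solve 3 (λ x g₃ g₄ →
  con 4 :* (con 1 :+ x) :+ con 3 :* con 0 :+ con 2 :* g₃ :+ g₄ := con 4 :* x :+ con 3 :* con 0 :+ con 2 :* (con 1 :+ g₃) :+ g₄ :+ con 2) refl x g₃ g₄)
μ-⟶ (move₃₄ g₁ g₂ t y g₄) = <-by t (solve 5 (λ g₁ g₂ t y g₄ →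
  con 4 :* g₁ :+ con 3 :* g₂ :+ con 2 :* (con 1 :+ t :+ y) :+ g₄ := con 4 :* g₁ :+ con 3 :* g₂ :+ con 2 :* y :+ (con 1 :+ t :+ g₄) :+ (con 1 :+ t)) refl g₁ g₂ t y g₄)
μ-⟶ (skip₂₄ g₁ y g₄) = <-by 1 (solve 3 (λ g₁ y g₄ →
  con 4 :* g₁ :+ con 3 :* (con 1 :+ y) :+ con 2 :* con 0 :+ g₄ := con 4 :* g₁ :+ con 3 :* y :+ con 2 :* con 0 :+ (con 1 :+ g₄) :+ con 2) refl g₁ y g₄)
μ-⟶ (skip₁₄ x g₄) = <-by 2 (solve 2 (λ x g₄ →
  con 4 :* (con 1 :+ x) :+ con 3 :* con 0 :+ con 2 :* con 0 :+ g₄ := con 4 :* x :+ con 3 :* con 0 :+ con 2 :* con 0 :+ (con 1 :+ g₄) :+ con 3) refl x g₄)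
μ-⟶ (take₄ g₁ g₂ g₃ t y) = <-by t (solve 5 (λ g₁ g₂ g₃ t y →
  con 4 :* g₁ :+ con 3 :* g₂ :+ con 2 :* g₃ :+ (con 1 :+ t :+ y) := con 4 :* g₁ :+ con 3 :* g₂ :+ con 2 :* g₃ :+ y :+ (con 1 :+ t)) refl g₁ g₂ g₃ t y)
μ-⟶ (take₃ g₁ g₂ y) = <-by 1 (solve 3 (λ g₁ g₂ y →
  con 4 :* g₁ :+ con 3 :* g₂ :+ con 2 :* (con 1 :+ y) :+ con 0 := con 4 :* g₁ :+ con 3 :* g₂ :+ con 2 :* y :+ con 0 :+ con 2) refl g₁ g₂ y)
μ-⟶ (take₂ g₁ y) = <-by 2 (solve 2 (λ g₁ y →
  con 4 :* g₁ :+ con 3 :* (con 1 :+ y) :+ con 2 :* con 0 :+ con 0 := con 4 :* g₁ :+ con 3 :* y :+ con 2 :* con 0 :+ con 0 :+ con 3) refl g₁ y)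
μ-⟶ (take₁ x) = <-by 3 (solve 1 (λ x →
  con 4 :* (con 1 :+ x) :+ con 3 :* con 0 :+ con 2 :* con 0 :+ con 0 := con 4 :* x :+ con 3 :* con 0 :+ con 2 :* con 0 :+ con 0 :+ con 4) refl x)

m+n≡m⇒n≡0 : ∀ m {n} → m + n ≡ m → n ≡ 0
m+n≡m⇒n≡0 zero    eq = eq
m+n≡m⇒n≡0 (suc m) eq = m+n≡m⇒n≡0 m (suc-injective eq)

g₁-positive : ∀ {g₁ q t} → q ≤ t → suc t < suc (g₁ + q) → ∃ λ x → g₁ ≡ suc x
g₁-positive {zero}  q≤t t<a = contradiction q≤t (<⇒≱ (s≤s⁻¹ t<a))
g₁-positive {suc x} _   _   = x , refl

admissible-move : ∀ {a B g t} (e : Fin 4) → Budget a B g → Admissible (profile B g) e t → suc t < a →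
                ∃ λ g′ → Σ (g ⟶ g′) λ mv → layer mv ≡ e × value B mv ≡ t
admissible-move {B = B} {⟪ g₁ , g₂ , g₃ , g₄ ⟫} zero refl refl t<a with g₁-positive {g₁} ≤-refl t<a
... | x , refl = _ , move₁₂ x g₂ g₃ g₄ , refl , refl
admissible-move {B = B} {⟪ g₁ , g₂ , g₃ , g₄ ⟫} (suc zero) refl (q₁≤t , inj₁ t<q₀) _
  with m≤n⇒∃[o]m+o≡n q₁≤t
... | t , refl with m≤n⇒∃[o]m+o≡n (+-cancelˡ-< (B + g₄ + g₃) t g₂ t<q₀)
...   | y , refl = _ , move₂₃ g₁ t y g₃ g₄ , refl , refl
admissible-move {B = B} {⟪ g₁ , g₂ , g₃ , g₄ ⟫} (suc zero) refl (_ , inj₂ (refl , q₀≡q₁)) t<a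
  with m+n≡m⇒n≡0 (B + g₄ + g₃) q₀≡q₁
... | refl with g₁-positive {g₁} (≤-reflexive q₀≡q₁) t<a
...   | x , refl = _ , skip₁₃ x g₃ g₄ , refl , refl
admissible-move {B = B} {⟪ g₁ , g₂ , g₃ , g₄ ⟫} (suc (suc zero)) refl (q₂≤t , inj₁ t<q₁) _
  with m≤n⇒∃[o]m+o≡n q₂≤t
... | t , refl with m≤n⇒∃[o]m+o≡n (+-cancelˡ-< (B + g₄) t g₃ t<q₁)
...   | y , refl = _ , move₃₄ g₁ g₂ t y g₄ , refl , refl
admissible-move {B = B} {⟪ g₁ , g₂ , g₃ , g₄ ⟫} (suc (suc zero)) refl (_ , inj₂ (refl , q₁≡q₂)) t<a
  with m+n≡m⇒n≡0 (B + g₄) q₁≡q₂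
admissible-move {B = B} {⟪ g₁ , suc y , _ , g₄ ⟫} (suc (suc zero)) refl (_ , inj₂ (refl , _)) _ | refl =
  _ , skip₂₄ g₁ y g₄ , refl , refl
admissible-move {B = B} {⟪ g₁ , zero , _ , g₄ ⟫} (suc (suc zero)) refl (_ , inj₂ (refl , q₁≡q₂)) t<a | refl
  with g₁-positive {g₁} (≤-reflexive (trans (+-identityʳ _) q₁≡q₂)) t<a
... | x , refl = _ , skip₁₄ x g₄ , refl , refl
admissible-move {B = B} {⟪ g₁ , g₂ , g₃ , g₄ ⟫} (suc (suc (suc zero))) refl (B≤t , inj₁ t<q₂) _
  with m≤n⇒∃[o]m+o≡n B≤t
... | t , refl with m≤n⇒∃[o]m+o≡n (+-cancelˡ-< B t g₄ t<q₂)
...   | y , refl = _ , take₄ g₁ g₂ g₃ t y , refl , refl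
admissible-move {B = B} {⟪ g₁ , g₂ , g₃ , g₄ ⟫} (suc (suc (suc zero))) refl (_ , inj₂ (refl , q₂≡q₃)) t<a
  with m+n≡m⇒n≡0 B q₂≡q₃
admissible-move {B = B} {⟪ g₁ , g₂ , suc y , _ ⟫} (suc (suc (suc zero))) refl (_ , inj₂ (refl , _)) _ | refl =
  _ , take₃ g₁ g₂ y , refl , refl
admissible-move {B = B} {⟪ g₁ , suc y , zero , _ ⟫} (suc (suc (suc zero))) refl (_ , inj₂ (refl , _)) _ | refl =
  _ , take₂ g₁ y , refl , refl
admissible-move {B = B} {⟪ g₁ , zero , zero , _ ⟫} (suc (suc (suc zero))) refl (_ , inj₂ (refl , q₂≡q₃)) t<a | refl
  with g₁-positive {g₁} (≤-reflexive (trans (+-identityʳ _) (trans (+-identityʳ _) q₂≡q₃))) t<a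
... | x , refl = _ , take₁ x , refl , refl

between-inside : ∀ x t y → Between (x + (suc t + y)) x (x + t) × 1 ≤ x + (suc t + y)
between-inside x t y = (m≤m+n x t , inj₁ t<) , ≤-<-trans z≤n t<
  where
  t< : x + t < x + (suc t + y)
  t< = +-monoʳ-< x (s≤s (m≤m+n t y))

between-edge : ∀ x → Between (x + 0) x x
between-edge x = ≤-refl , inj₂ (refl , +-identityʳ x)

2≤+1⇒1≤ : ∀ x → 2 ≤ x + 1 → 1 ≤ x
2≤+1⇒1≤ x h = s≤s⁻¹ (subst (2 ≤_) (+-comm x 1) h)

2≤+0⇒1≤ : ∀ x → 2 ≤ x + 0 → 1 ≤ x
2≤+0⇒1≤ x h = ≤-trans (n≤1+n 1) (subst (2 ≤_) (+-identityʳ x) h)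

reply-playable : ∀ {B g g′} → 2 ≤ head (profile B g) → (mv : g ⟶ g′) → Realisable mv →
                 Playable (profile B g) (layer mv) (value B mv)
reply-playable {B} _  (move₁₂ _ _ _ _)     _ = refl
reply-playable {B} _  (move₂₃ _ t y g₃ g₄) _ = between-inside (B + g₄ + g₃) t y
reply-playable {B} h  (skip₁₃ _ g₃ g₄)     _ = between-edge (B + g₄ + g₃) , ≤-trans (n≤1+n 1) h
reply-playable {B} _  (move₃₄ _ _ t y g₄)  _ = between-inside (B + g₄) t y
reply-playable {B} h  (skip₂₄ _ _ g₄)   refl = between-edge (B + g₄) , 2≤+1⇒1≤ (B + g₄ + 0) h
reply-playable {B} h  (skip₁₄ _ g₄)        _ = between-edge (B + g₄) , 2≤+0⇒1≤ (B + g₄ + 0) h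
reply-playable {B} _  (take₄ _ _ _ t y)    _ = between-inside B t y
reply-playable {B} h  (take₃ _ _ _) (refl , refl) =
  between-edge B , 2≤+1⇒1≤ (B + 0) (subst (2 ≤_) (+-identityʳ _) h)
reply-playable {B} h  (take₂ _ _)       refl = between-edge B , subst (1 ≤_) (+-identityʳ _) (2≤+1⇒1≤ (B + 0 + 0) h)
reply-playable {B} h  (take₁ _)            _ = between-edge B , 2≤+0⇒1≤ (B + 0) (subst (2 ≤_) (+-identityʳ _) h)

-- Player 1's strategy

extend-represents : ∀ {k π q g} → Represents k (reverse π) q → g ≤ length (reverse π) → (e : Fin k) →
                    lds (reverse π) g ≡ toℕ e → Represents k (reverse (extend (suc g) π)) (raise e (suc (lis (reverse π) g)) q)
extend-represents {π = π} {g = g} r g≤n e layer =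
  subst (λ ρ → Represents _ ρ (raise e (suc (lis (reverse π) g)) _)) (sym (reverse-extend g π)) (represents-push r g≤n e layer)

module Strategy (a : ℕ) where

  record Target (B : ℕ) (g : Position) : Set where
    field
      budget : Budget a B g
      isP    : IsP g
      2≤top  : 2 ≤ head (profile B g)

  top<a : ∀ {B g} → Budget a B g → head (profile B g) < a
  top<a {g = ⟪ g₁ , _ , _ , _ ⟫} budget = subst (_ <_) budget (s≤s (m≤n+m _ g₁))

  mutual
    loses : ∀ {π B g} → Acc _<_ (μ g) → Represents 4 (reverse π) (profile B g) → Target B g → Lose a 5 π
    loses {π} {B} {g} (acc smaller) r target = lose answer
      where
      open Target target
      ρ : List ℕ
      ρ = reverse π

      counter : ∀ {g₀} → g₀ ≤ length ρ → (e : Fin 4) → lds ρ g₀ ≡ toℕ e → suc (lis ρ g₀) < a →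
                Win a 5 (extend (suc g₀) π)
      counter {g₀} g₀≤n e depth short with admissible-move {B = B} {g} e budget (admissible r e depth) short
      ... | g′ , mv , layer≡ , value≡ with ¬P⟶P g′ (P⟶¬P isP mv)
      ...   | g″ , (mv′ , realisable) , isP″ =
        wins (smaller (<-trans (μ-⟶ mv′) (μ-⟶ mv))) r′ (reply-playable 2≤top′ mv′ realisable)
             (profile-⟶ B′ mv′) target″
        where
        B′ : ℕ
        B′ = base B mv
        2≤top′ : 2 ≤ head (profile B′ g′)
        2≤top′ = ≤-trans 2≤top (top-⟶ B mv)
        r′ : Represents 4 (reverse (extend (suc g₀) π)) (profile B′ g′)
        r′ = subst (Represents 4 _) (sym (trans (profile-⟶ B mv) (cong₂ (λ e v → raise e (suc v) _) layer≡ value≡)))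
                   (extend-represents {π = π} r g₀≤n e depth)
        target″ : Target (base B′ mv′) g″
        target″ = record
          { budget = budget-⟶ B′ mv′ (budget-⟶ B mv budget)
          ; isP    = isP″
          ; 2≤top  = ≤-trans 2≤top′ (top-⟶ B′ mv′)
          }

      answer : ∀ m → Legal π m → Ended a 5 (extend m π) ⊎ Win a 5 (extend m π)
      answer (suc g₀) (_ , s≤s g₀≤n) with 4 ≤? lds ρ g₀ | a ≤? suc (lis ρ g₀)
      ... | yes deep    | _        = inj₁ (ends-by-lds a π g₀ deep)
      ... | no  _       | yes long = inj₁ (ends-by-lis a π g₀ long)
      ... | no  shallow | no short =
        inj₂ (counter (subst (g₀ ≤_) (sym (length-reverse π)) g₀≤n) (fromℕ< (≰⇒> shallow))
                      (sym (toℕ-fromℕ< _)) (≰⇒> short))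

    wins : ∀ {π q B g} {e : Fin 4} {t} → Acc _<_ (μ g) → Represents 4 (reverse π) q → Playable q e t →
           profile B g ≡ raise e (suc t) q → Target B g → Win a 5 π
    wins {π} {q} {B} {g} {e} accessible r playable eq target with playable-gap r e playable
    ... | g₁ , g₁≤n , depth , value≡ =
      win (suc g₁) (s≤s z≤n , s≤s (subst (g₁ ≤_) (length-reverse π) g₁≤n))
          (represents⇒¬ended r′ (top<a {B} {g} (Target.budget target))) (loses accessible r′ target)
      where
      r′ : Represents 4 (reverse (extend (suc g₁) π)) (profile B g)
      r′ = subst (Represents 4 _) (trans (cong (λ v → raise e (suc v) q) value≡) (sym eq))
                 (extend-represents {π = π} r g₁≤n e depth)

opening-P : ∀ c → IsP ⟪ 2 + c , 0 , 2 , 0 ⟫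
opening-P c = lemma (kind c)
  where
  lemma : ∀ k → 0 ≡ table (next (next k)) 0 2
  lemma none = refl
  lemma odd  = refl
  lemma even = refl

theorem4 : (a : ℕ) → 5 ≤ a → Player1Wins a 5
theorem4 a 5≤a with m≤n⇒∃[o]m+o≡n 5≤a
... | c , refl = win 1 (s≤s z≤n , s≤s z≤n) (represents⇒¬ended after-1 (s≤s (s≤s z≤n))) (lose answer)
  where
  open Strategy (5 + c)
  π₁ : List ℕ
  π₁ = extend 1 []
  after-1 : Represents 4 (reverse π₁) (1 ∷ 0 ∷ 0 ∷ 0 ∷ [])
  after-1 = extend-represents {π = []} (represents-[] 4) z≤n zero refl
  target : Target 0 ⟪ 2 + c , 0 , 2 , 0 ⟫
  target = record { budget = cong (3 +_) (+-comm c 2) ; isP = opening-P c ; 2≤top = ≤-refl }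
  -- The answers 1 and 2 give the profiles (1, 1, 0, 0) and (2, 0, 0, 0); playing (1, 1) raises both to (2, 2, 0, 0).
  answer : ∀ m → Legal π₁ m → Ended (5 + c) 5 (extend m π₁) ⊎ Win (5 + c) 5 (extend m π₁)
  answer 1 _ = inj₂ (wins {e = suc zero} {1} (<-wellFounded _) (extend-represents {π = π₁} after-1 z≤n (suc zero) refl)
                          ((≤-refl , inj₂ (refl , refl)) , ≤-refl) refl target)
  answer 2 _ = inj₂ (wins {e = suc zero} {1} (<-wellFounded _) (extend-represents {π = π₁} after-1 (s≤s z≤n) zero refl)
                          ((z≤n , inj₁ ≤-refl) , s≤s z≤n) refl target)
  answer (suc (suc (suc _))) (_ , s≤s (s≤s ()))
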